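{- (1) For all $n\geq 0$, $c_{7,3}(16n+5)\equiv 0\pmod 2$. (2) For $n\geq 0$, $c_{7,3}(16n+13)\equiv 0\pmod 2$ if and only if $n$ cannot be represented in the form $n=5k^2+4k$ for some integer $k$. (3) Let $p$ be a prime with $p\equiv 11$ or $19\pmod{20}$. For all integers $n,k\geq 0$ with $p\nmid n$, \[ c_{7,3}\left(8p^{2k+1}n+\frac{34p^{2k+2}+1}{5}\right)\equiv 0\pmod 2. \]
   Context: For complex $a,b$ the false theta function is $\Psi(a,b):=\sum_{n=0}^\infty a^{n(n+1)/2}b^{n(n-1)/2}-\sum_{n=-\infty}^{ -1}a^{n(n+1)/2}b^{n(n-1)/2}$. For positive integers $r,s$, the integers $c_{r,s}(n)$ ($n\ge 0$) are defined by the power series identity $\sum_{n=0}^\infty c_{r,s}(n)q^n=\dfrac{1}{\Psi(-q^r,q^s)}$ (the denominator is a power series in $q$ with constant term $1$). -}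

module Defs where

open import Data.Nat as ℕ using (ℕ; zero; suc; _∸_)
open import Data.Integer using (ℤ; +_; -_; _+_; _-_; _*_)
open import Data.Bool using (if_then_else_)
open import Relation.Nullary.Decidable using (⌊_⌋)
open import Relation.Binary.PropositionalEquality using (_≡_)

tri : ℕ → ℕ
tri zero    = 0
tri (suc n) = suc n ℕ.+ tri n

negOnePow : ℕ → ℤ
negOnePow zero    = + 1
negOnePow (suc t) = - negOnePow t

Σ< : ℕ → (ℕ → ℤ) → ℤ
Σ< zero    f = + 0
Σ< (suc N) f = Σ< N f + f N

ifExp : ℕ → ℕ → ℤ → ℤ
ifExp e N v = if ⌊ e ℕ.≟ N ⌋ then v else + 0

-- Coefficient of q^N in Ψ(-q^r, q^s).
-- Term n ≥ 0 : (-q^r)^{n(n+1)/2} q^{s n(n-1)/2} = (-1)^{tri n} q^{r tri n + s (tri n - n)}.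
-- Term n = -m, m ≥ 1 : (-q^r)^{m(m-1)/2} q^{s m(m+1)/2}
--                     = (-1)^{tri m - m} q^{r (tri m - m) + s tri m}, subtracted.
-- Exponents are ≥ n (resp. ≥ m), so only n ≤ N (resp. 1 ≤ m ≤ N) contribute.
psiCoeff : ℕ → ℕ → ℕ → ℤ
psiCoeff r s N =
  Σ< (suc N) (λ n → ifExp (r ℕ.* tri n ℕ.+ s ℕ.* (tri n ∸ n)) N (negOnePow (tri n)))
  - Σ< N (λ j → ifExp (r ℕ.* (tri (suc j) ∸ suc j) ℕ.+ s ℕ.* tri (suc j)) N
                        (negOnePow (tri (suc j) ∸ suc j)))

conv : (ℕ → ℤ) → (ℕ → ℤ) → ℕ → ℤ
conv a b N = Σ< (suc N) (λ j → a j * b (N ∸ j))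

one : ℕ → ℤ
one zero    = + 1
one (suc _) = + 0

-- c is the coefficient sequence of 1 / Ψ(-q^r, q^s), i.e. (Σ c(n) q^n) · Ψ(-q^r,q^s) = 1
IsC : ℕ → ℕ → (ℕ → ℤ) → Set
IsC r s c = ∀ N → conv (psiCoeff r s) c N ≡ one N

module Submission where

-- Modulo 2 the signs of Ψ disappear: F = Ψ(-q⁷, q³) ≡ ∑ q^(5x² + 2x) over x ∈ ℤ, and C = ∑ c(n) qⁿ is
-- its inverse over 𝔽₂. Squaring is the Frobenius A(q)² = A(q²), so C = F(q) C(q²) = F(q) F(q²) C(q⁴).
-- Explicit bijections between representations identify the parts of F(q) F(q²) = ∑ q^(Q₂ a + 2 Q₂ b)
-- with exponents 4k + 1 and 4k + 3 as q² G(q) G(q²) and G(q) E(q²), where G and E are the theta series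
-- of 5x² + 4x and 5x² + x, and show that P = G F satisfies P(2n + 1) = P(n). Combining these gives
-- c(16n + 5) ≡ 0, c(16n + 13) ≡ [qⁿ] G, which is 1 exactly when n = 5k² + 4k, and
-- c(8n + 7) ≡ #{(x , y) ∣ 5x² + 4x + 5y² + y = n}. A solution of the last equation would give
-- 20n + 17 = (10x + 4)² + (10y + 1)², but for the indices in (3), 20n + 17 = p^(2k+1) w with p ∤ w,
-- and a prime p ≡ 3 (mod 4) dividing a sum of two squares divides both of them (by Fermat's little
-- theorem), so descent on k gives a contradiction.

open import Defs
open import Data.Nat.Base using (ℕ)
open import Data.Integer.Base using (ℤ)

module PowerSeries where
  open import Data.Nat.Base as ℕ using (ℕ; zero; suc; _≤_; _<_; z≤n; s≤s)
  import Data.Nat.Properties as ℕₚ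
  open import Data.Nat.Properties using (_≟_)
  open import Data.Parity.Base using (Parity; 0ℙ; 1ℙ; _*_) renaming (_+_ to _⊕_)
  open import Data.Parity.Properties
    using (+-comm; +-assoc; +-identityʳ; *-comm; *-assoc; *-idem; *-distribˡ-+; *-zeroʳ; p+p≡0ℙ
          ; +-commutativeSemigroup)
  open import Algebra.Properties.CommutativeSemigroup +-commutativeSemigroup using (interchange)
  open import Algebra.Bundles using (CommutativeMonoid)
  import Algebra.Solver.CommutativeMonoid as CommutativeMonoidSolver
  open import Data.Bool.Base using (if_then_else_)
  open import Data.Fin.Patterns using (0F; 1F; 2F)
  open import Data.Product.Base using (∃; _×_; _,_)
  open import Data.Sum.Base using (_⊎_; inj₁; inj₂)
  open import Data.Vec.Base using ([]; _∷_)
  open import Function.Base using (_∘_)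
  open import Level using (0ℓ)
  open import Relation.Binary.PropositionalEquality
  import Relation.Binary.Reasoning.Setoid as SetoidReasoning
  open import Relation.Nullary.Decidable.Core using (Dec; does; yes; no; _×-dec_)
  open import Relation.Nullary.Negation.Core using (¬_; contradiction)

  𝟙 : ∀ {P : Set} → Dec P → Parity
  𝟙 p = if does p then 1ℙ else 0ℙ

  𝟙-yes : ∀ {P : Set} (d : Dec P) → P → 𝟙 d ≡ 1ℙ
  𝟙-yes (yes _) _ = refl
  𝟙-yes (no ¬p) p = contradiction p ¬p

  𝟙-no : ∀ {P : Set} (d : Dec P) → ¬ P → 𝟙 d ≡ 0ℙ
  𝟙-no (yes p) ¬p = contradiction p ¬p
  𝟙-no (no _)  _  = refl

  𝟙≡1ℙ⇒ : ∀ {P : Set} (d : Dec P) → 𝟙 d ≡ 1ℙ → P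
  𝟙≡1ℙ⇒ (yes p) _ = p

  𝟙-⇔ : ∀ {P Q : Set} (p : Dec P) (q : Dec Q) → (P → Q) → (Q → P) → 𝟙 p ≡ 𝟙 q
  𝟙-⇔ (yes _) (yes _) _   _   = refl
  𝟙-⇔ (yes p) (no ¬q) P→Q _   = contradiction (P→Q p) ¬q
  𝟙-⇔ (no ¬p) (yes q) _   Q→P = contradiction (Q→P q) ¬p
  𝟙-⇔ (no _)  (no _)  _   _   = refl

  𝟙-× : ∀ {P Q : Set} (p : Dec P) (q : Dec Q) → 𝟙 p * 𝟙 q ≡ 𝟙 (p ×-dec q)
  𝟙-× (yes _) (yes _) = refl
  𝟙-× (yes _) (no _)  = refl
  𝟙-× (no _)  _       = refl

  𝟙-*-guard : ∀ {P : Set} (p : Dec P) {a} → (P → a ≡ 1ℙ) → 𝟙 p * a ≡ 𝟙 p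
  𝟙-*-guard (yes p) P⇒a≡1 = P⇒a≡1 p
  𝟙-*-guard (no _)  _     = refl

  𝟙-elim : ∀ {P : Set} (p : Dec P) {a} → (P → a ≡ 1ℙ) → (¬ P → a ≡ 0ℙ) → a ≡ 𝟙 p
  𝟙-elim (yes p) P⇒a≡1 _  = P⇒a≡1 p
  𝟙-elim (no ¬p) _ ¬P⇒a≡0 = ¬P⇒a≡0 ¬p

  0ℙ≢1ℙ : 0ℙ ≢ 1ℙ
  0ℙ≢1ℙ ()

  ≢1ℙ⇒≡0ℙ : ∀ {a} → a ≢ 1ℙ → a ≡ 0ℙ
  ≢1ℙ⇒≡0ℙ {0ℙ} _   = refl
  ≢1ℙ⇒≡0ℙ {1ℙ} a≢1 = contradiction refl a≢1

  x⊕y⊕y≡x : ∀ x y → (x ⊕ y) ⊕ y ≡ x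
  x⊕y⊕y≡x x y = trans (+-assoc x y y) (trans (cong (λ z → x ⊕ z) (p+p≡0ℙ y)) (+-identityʳ x))

  double : ℕ → ℕ
  double zero    = zero
  double (suc m) = suc (suc (double m))

  double≡2* : ∀ n → double n ≡ 2 ℕ.* n
  double≡2* zero    = refl
  double≡2* (suc n) = trans (cong (suc ∘ suc) (double≡2* n)) (sym (ℕₚ.*-suc 2 n))

  double-double≡4* : ∀ n → double (double n) ≡ 4 ℕ.* n
  double-double≡4* n = trans (double≡2* (double n)) (trans (cong (2 ℕ.*_) (double≡2* n)) (sym (ℕₚ.*-assoc 2 2 n)))

  double-injective : ∀ {m n} → double m ≡ double n → m ≡ n
  double-injective {zero}  {zero}  _  = refl
  double-injective {suc m} {suc n} eq = cong suc (double-injective (ℕₚ.suc-injective (ℕₚ.suc-injective eq)))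

  double≢suc-double : ∀ m n → double m ≢ suc (double n)
  double≢suc-double (suc m) (suc n) eq = double≢suc-double m n (ℕₚ.suc-injective (ℕₚ.suc-injective eq))

  n≤double : ∀ n → n ≤ double n
  n≤double zero    = z≤n
  n≤double (suc n) = s≤s (ℕₚ.m≤n⇒m≤1+n (n≤double n))

  even⊎odd : ∀ n → ∃ λ m → n ≡ double m ⊎ n ≡ suc (double m)
  even⊎odd zero = 0 , inj₁ refl
  even⊎odd (suc n) with even⊎odd n
  ... | m , inj₁ n≡2m   = m , inj₂ (cong suc n≡2m)
  ... | m , inj₂ n≡2m+1 = suc m , inj₁ (cong suc n≡2m+1)

  ∑< : ℕ → (ℕ → Parity) → Parity
  ∑< zero    f = 0ℙ
  ∑< (suc n) f = ∑< n f ⊕ f n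

  ∑<-cong : ∀ n {f g : ℕ → Parity} → (∀ i → i < n → f i ≡ g i) → ∑< n f ≡ ∑< n g
  ∑<-cong zero    f≗g = refl
  ∑<-cong (suc n) f≗g = cong₂ _⊕_ (∑<-cong n (λ i i<n → f≗g i (ℕₚ.m<n⇒m<1+n i<n))) (f≗g n ℕₚ.≤-refl)

  ∑<-0 : ∀ n (f : ℕ → Parity) → (∀ i → i < n → f i ≡ 0ℙ) → ∑< n f ≡ 0ℙ
  ∑<-0 zero    f f≗0 = refl
  ∑<-0 (suc n) f f≗0 = cong₂ _⊕_ (∑<-0 n f (λ i i<n → f≗0 i (ℕₚ.m<n⇒m<1+n i<n))) (f≗0 n ℕₚ.≤-refl)

  ∑<-+ : ∀ n (f g : ℕ → Parity) → ∑< n (λ i → f i ⊕ g i) ≡ ∑< n f ⊕ ∑< n g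
  ∑<-+ zero    f g = refl
  ∑<-+ (suc n) f g = trans (cong (_⊕ (f n ⊕ g n)) (∑<-+ n f g)) (interchange (∑< n f) (∑< n g) (f n) (g n))

  ∑<-*ˡ : ∀ n a (f : ℕ → Parity) → a * ∑< n f ≡ ∑< n (λ i → a * f i)
  ∑<-*ˡ zero    a f = *-zeroʳ a
  ∑<-*ˡ (suc n) a f = trans (*-distribˡ-+ a (∑< n f) (f n)) (cong (_⊕ (a * f n)) (∑<-*ˡ n a f))

  ∑<-comm : ∀ m n (f : ℕ → ℕ → Parity) →
            ∑< m (λ i → ∑< n (f i)) ≡ ∑< n (λ j → ∑< m (λ i → f i j))
  ∑<-comm zero    n f = sym (∑<-0 n _ (λ _ _ → refl))
  ∑<-comm (suc m) n f = trans (cong (_⊕ ∑< n (f m)) (∑<-comm m n f)) (sym (∑<-+ n _ (f m)))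

  ∑<-extend : ∀ {m n} (f : ℕ → Parity) → m ≤ n → (∀ i → m ≤ i → i < n → f i ≡ 0ℙ) →
              ∑< n f ≡ ∑< m f
  ∑<-extend {n = zero}  f z≤n f≗0 = refl
  ∑<-extend {m} {suc n} f m≤1+n f≗0 with m ℕₚ.≤? n
  ... | yes m≤n = trans (cong₂ _⊕_ (∑<-extend f m≤n (λ i m≤i i<n → f≗0 i m≤i (ℕₚ.m<n⇒m<1+n i<n)))
                                   (f≗0 n m≤n ℕₚ.≤-refl))
                        (+-identityʳ (∑< m f))
  ... | no m≰n  = cong (λ k → ∑< k f) (ℕₚ.≤-antisym (ℕₚ.≰⇒> m≰n) m≤1+n)

  ∑<-δ : ∀ n a → a < n → ∑< n (λ i → 𝟙 (i ≟ a)) ≡ 1ℙ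
  ∑<-δ (suc n) a a<1+n with ℕₚ.m≤n⇒m<n∨m≡n (ℕₚ.≤-pred a<1+n)
  ... | inj₁ a<n  = trans (cong₂ _⊕_ (∑<-δ n a a<n) (𝟙-no (n ≟ a) (ℕₚ.>⇒≢ a<n))) (+-identityʳ 1ℙ)
  ... | inj₂ refl = cong₂ _⊕_ (∑<-0 n _ (λ i i<a → 𝟙-no (i ≟ a) (ℕₚ.<⇒≢ i<a))) (𝟙-yes (a ≟ a) refl)

  ∑<-witness : ∀ n (f : ℕ → Parity) → ∑< n f ≡ 1ℙ → ∃ λ i → i < n × f i ≡ 1ℙ
  ∑<-witness (suc n) f sum≡1 with f n in fn≡
  ... | 1ℙ = n , ℕₚ.≤-refl , fn≡
  ... | 0ℙ with ∑<-witness n f (trans (sym (+-identityʳ (∑< n f))) sum≡1)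
  ...   | i , i<n , fi≡1 = i , ℕₚ.m<n⇒m<1+n i<n , fi≡1

  antidiagonal : ℕ → (ℕ → ℕ → Parity) → Parity
  antidiagonal zero    f = f 0 0
  antidiagonal (suc N) f = f 0 (suc N) ⊕ antidiagonal N (λ i j → f (suc i) j)

  antidiagonal-cong : ∀ N {f g : ℕ → ℕ → Parity} →
                      (∀ i j → i ℕ.+ j ≡ N → f i j ≡ g i j) → antidiagonal N f ≡ antidiagonal N g
  antidiagonal-cong zero    f≗g = f≗g 0 0 refl
  antidiagonal-cong (suc N) f≗g =
    cong₂ _⊕_ (f≗g 0 (suc N) refl) (antidiagonal-cong N (λ i j i+j≡N → f≗g (suc i) j (cong suc i+j≡N)))

  antidiagonal-0 : ∀ N (f : ℕ → ℕ → Parity) → (∀ i j → f i j ≡ 0ℙ) → antidiagonal N f ≡ 0ℙ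
  antidiagonal-0 zero    f f≗0 = f≗0 0 0
  antidiagonal-0 (suc N) f f≗0 = cong₂ _⊕_ (f≗0 0 (suc N)) (antidiagonal-0 N _ (λ i → f≗0 (suc i)))

  antidiagonal-+ : ∀ N (f g : ℕ → ℕ → Parity) →
                   antidiagonal N (λ i j → f i j ⊕ g i j) ≡ antidiagonal N f ⊕ antidiagonal N g
  antidiagonal-+ zero    f g = refl
  antidiagonal-+ (suc N) f g =
    trans (cong ((f 0 (suc N) ⊕ g 0 (suc N)) ⊕_) (antidiagonal-+ N _ _))
          (interchange (f 0 (suc N)) (g 0 (suc N)) _ _)

  antidiagonal-*ˡ : ∀ N a (f : ℕ → ℕ → Parity) → a * antidiagonal N f ≡ antidiagonal N (λ i j → a * f i j)
  antidiagonal-*ˡ zero    a f = refl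
  antidiagonal-*ˡ (suc N) a f = trans (*-distribˡ-+ a _ _) (cong ((a * f 0 (suc N)) ⊕_) (antidiagonal-*ˡ N a _))

  antidiagonal-*ʳ : ∀ N a (f : ℕ → ℕ → Parity) → antidiagonal N f * a ≡ antidiagonal N (λ i j → f i j * a)
  antidiagonal-*ʳ N a f = trans (*-comm _ a)
    (trans (antidiagonal-*ˡ N a f) (antidiagonal-cong N (λ i j _ → *-comm a (f i j))))

  antidiagonal-last : ∀ N (f : ℕ → ℕ → Parity) →
                      antidiagonal (suc N) f ≡ antidiagonal N (λ i j → f i (suc j)) ⊕ f (suc N) 0
  antidiagonal-last zero    f = refl
  antidiagonal-last (suc N) f =
    trans (cong (f 0 (suc (suc N)) ⊕_) (antidiagonal-last N (λ i j → f (suc i) j)))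
          (sym (+-assoc (f 0 (suc (suc N))) _ _))

  antidiagonal-swap : ∀ N (f : ℕ → ℕ → Parity) → antidiagonal N f ≡ antidiagonal N (λ i j → f j i)
  antidiagonal-swap zero    f = refl
  antidiagonal-swap (suc N) f =
    trans (cong (f 0 (suc N) ⊕_) (antidiagonal-swap N (λ i j → f (suc i) j)))
          (trans (+-comm (f 0 (suc N)) _) (sym (antidiagonal-last N (λ i j → f j i))))

  antidiagonal-assoc : ∀ N (f : ℕ → ℕ → ℕ → Parity) →
    antidiagonal N (λ k l → antidiagonal k (λ i j → f i j l)) ≡
    antidiagonal N (λ i m → antidiagonal m (λ j l → f i j l))
  antidiagonal-assoc zero    f = refl
  antidiagonal-assoc (suc N) f = begin
    f 0 0 (suc N) ⊕ antidiagonal N (λ k l → f 0 (suc k) l ⊕ antidiagonal k (λ i j → f (suc i) j l))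
      ≡⟨ cong (f 0 0 (suc N) ⊕_) (antidiagonal-+ N _ _) ⟩
    f 0 0 (suc N) ⊕ (first-row ⊕ antidiagonal N (λ k l → antidiagonal k (λ i j → f (suc i) j l)))
      ≡⟨ cong (λ s → f 0 0 (suc N) ⊕ (first-row ⊕ s)) (antidiagonal-assoc N (f ∘ suc)) ⟩
    f 0 0 (suc N) ⊕ (first-row ⊕ antidiagonal N (λ i m → antidiagonal m (λ j l → f (suc i) j l)))
      ≡⟨ +-assoc (f 0 0 (suc N)) first-row _ ⟨
    (f 0 0 (suc N) ⊕ first-row) ⊕ antidiagonal N (λ i m → antidiagonal m (λ j l → f (suc i) j l)) ∎
    where
    open ≡-Reasoning
    first-row = antidiagonal N (λ k l → f 0 (suc k) l)

  -- On a symmetric summand the off-diagonal terms cancel in pairs.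
  antidiagonal-symmetric-step : ∀ N (f : ℕ → ℕ → Parity) → (∀ i j → f i j ≡ f j i) →
                                antidiagonal (suc (suc N)) f ≡ antidiagonal N (λ i j → f (suc i) (suc j))
  antidiagonal-symmetric-step N f sym-f = begin
    f 0 (suc (suc N)) ⊕ antidiagonal (suc N) (λ i j → f (suc i) j)
      ≡⟨ cong (f 0 (suc (suc N)) ⊕_) (antidiagonal-last N (λ i j → f (suc i) j)) ⟩
    f 0 (suc (suc N)) ⊕ (inner ⊕ f (suc (suc N)) 0)
      ≡⟨ cong (λ s → f 0 (suc (suc N)) ⊕ (inner ⊕ s)) (sym-f (suc (suc N)) 0) ⟩
    f 0 (suc (suc N)) ⊕ (inner ⊕ f 0 (suc (suc N)))
      ≡⟨ cong (f 0 (suc (suc N)) ⊕_) (+-comm inner _) ⟩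
    f 0 (suc (suc N)) ⊕ (f 0 (suc (suc N)) ⊕ inner)
      ≡⟨ sym (+-assoc (f 0 (suc (suc N))) _ inner) ⟩
    (f 0 (suc (suc N)) ⊕ f 0 (suc (suc N))) ⊕ inner
      ≡⟨ cong (_⊕ inner) (p+p≡0ℙ (f 0 (suc (suc N)))) ⟩
    inner ∎
    where
    open ≡-Reasoning
    inner = antidiagonal N (λ i j → f (suc i) (suc j))

  antidiagonal-symmetric-double : ∀ m (f : ℕ → ℕ → Parity) → (∀ i j → f i j ≡ f j i) →
                                  antidiagonal (double m) f ≡ f m m
  antidiagonal-symmetric-double zero    f sym-f = refl
  antidiagonal-symmetric-double (suc m) f sym-f =
    trans (antidiagonal-symmetric-step (double m) f sym-f)
          (antidiagonal-symmetric-double m _ (λ i j → sym-f (suc i) (suc j)))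

  antidiagonal-symmetric-odd : ∀ m (f : ℕ → ℕ → Parity) → (∀ i j → f i j ≡ f j i) →
                               antidiagonal (suc (double m)) f ≡ 0ℙ
  antidiagonal-symmetric-odd zero    f sym-f = trans (cong (f 0 1 ⊕_) (sym-f 1 0)) (p+p≡0ℙ (f 0 1))
  antidiagonal-symmetric-odd (suc m) f sym-f =
    trans (antidiagonal-symmetric-step (suc (double m)) f sym-f)
          (antidiagonal-symmetric-odd m _ (λ i j → sym-f (suc i) (suc j)))

  ∑<-antidiagonal : ∀ N (f : ℕ → ℕ → Parity) → ∑< (suc N) (λ i → f i (N ℕ.∸ i)) ≡ antidiagonal N f
  ∑<-antidiagonal zero    f = refl
  ∑<-antidiagonal (suc N) f = trans (∑<-first (suc N) _)
    (cong (f 0 (suc N) ⊕_) (∑<-antidiagonal N (λ i j → f (suc i) j)))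
    where
    ∑<-first : ∀ n (g : ℕ → Parity) → ∑< (suc n) g ≡ g 0 ⊕ ∑< n (g ∘ suc)
    ∑<-first zero    g = +-comm 0ℙ (g 0)
    ∑<-first (suc n) g = trans (cong (_⊕ g (suc n)) (∑<-first n g)) (+-assoc (g 0) _ _)

  Series : Set
  Series = ℕ → Parity

  infix 4 _≈_
  _≈_ : Series → Series → Set
  A ≈ B = ∀ n → A n ≡ B n

  infixl 7 _⊛_
  _⊛_ : Series → Series → Series
  (A ⊛ B) N = antidiagonal N (λ i j → A i * B j)

  1ₛ : Series
  1ₛ zero    = 1ℙ
  1ₛ (suc _) = 0ℙ

  ⊛-cong : ∀ {A A′ B B′} → A ≈ A′ → B ≈ B′ → A ⊛ B ≈ A′ ⊛ B′
  ⊛-cong A≈A′ B≈B′ N = antidiagonal-cong N (λ i j _ → cong₂ _*_ (A≈A′ i) (B≈B′ j))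

  ⊛-comm : ∀ A B → A ⊛ B ≈ B ⊛ A
  ⊛-comm A B N = trans (antidiagonal-swap N _) (antidiagonal-cong N (λ i j _ → *-comm (A j) (B i)))

  ⊛-assoc : ∀ A B C → (A ⊛ B) ⊛ C ≈ A ⊛ (B ⊛ C)
  ⊛-assoc A B C N = begin
    antidiagonal N (λ k l → antidiagonal k (λ i j → A i * B j) * C l)
      ≡⟨ antidiagonal-cong N (λ k l _ → antidiagonal-*ʳ k (C l) _) ⟩
    antidiagonal N (λ k l → antidiagonal k (λ i j → (A i * B j) * C l))
      ≡⟨ antidiagonal-assoc N (λ i j l → (A i * B j) * C l) ⟩
    antidiagonal N (λ i m → antidiagonal m (λ j l → (A i * B j) * C l))
      ≡⟨ antidiagonal-cong N (λ i m _ → trans (antidiagonal-cong m (λ j l _ → *-assoc (A i) (B j) (C l)))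
                                              (sym (antidiagonal-*ˡ m (A i) _))) ⟩
    antidiagonal N (λ i m → A i * antidiagonal m (λ j l → B j * C l)) ∎
    where open ≡-Reasoning

  ⊛-identityˡ : ∀ A → 1ₛ ⊛ A ≈ A
  ⊛-identityˡ A zero    = refl
  ⊛-identityˡ A (suc N) = trans (cong (A (suc N) ⊕_) (antidiagonal-0 N _ (λ _ _ → refl))) (+-identityʳ _)

  ⊛-identityʳ : ∀ A → A ⊛ 1ₛ ≈ A
  ⊛-identityʳ A N = trans (⊛-comm A 1ₛ N) (⊛-identityˡ A N)

  ⊛-commutativeMonoid : CommutativeMonoid 0ℓ 0ℓ
  ⊛-commutativeMonoid = record
    { Carrier = Series
    ; _≈_     = _≈_
    ; _∙_     = _⊛_
    ; ε       = 1ₛ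
    ; isCommutativeMonoid = record
      { isMonoid = record
        { isSemigroup = record
          { isMagma = record
            { isEquivalence = record
              { refl  = λ _ → refl
              ; sym   = λ A≈B n → sym (A≈B n)
              ; trans = λ A≈B B≈C n → trans (A≈B n) (B≈C n)
              }
            ; ∙-cong = ⊛-cong
            }
          ; assoc = ⊛-assoc
          }
        ; identity = ⊛-identityˡ , ⊛-identityʳ
        }
      ; comm = ⊛-comm
      }
    }

  open CommutativeMonoid ⊛-commutativeMonoid public
    using () renaming (refl to ≈-refl; sym to ≈-sym; trans to ≈-trans; setoid to ≈-setoid)

  dilate : Series → Series
  dilate A zero          = A 0
  dilate A (suc zero)    = 0ℙ
  dilate A (suc (suc n)) = dilate (A ∘ suc) n

  evenPart oddPart : Series → Series
  evenPart A m = A (double m)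
  oddPart  A m = A (suc (double m))

  dilate-double : ∀ A m → dilate A (double m) ≡ A m
  dilate-double A zero    = refl
  dilate-double A (suc m) = dilate-double (A ∘ suc) m

  dilate-odd : ∀ A m → dilate A (suc (double m)) ≡ 0ℙ
  dilate-odd A zero    = refl
  dilate-odd A (suc m) = dilate-odd (A ∘ suc) m

  evenPart-oddPart-≈ : ∀ {A B} → evenPart A ≈ evenPart B → oddPart A ≈ oddPart B → A ≈ B
  evenPart-oddPart-≈ even≈ odd≈ n with even⊎odd n
  ... | m , inj₁ refl = even≈ m
  ... | m , inj₂ refl = odd≈ m

  dilate-cong : ∀ {A B} → A ≈ B → dilate A ≈ dilate B
  dilate-cong {A} {B} A≈B = evenPart-oddPart-≈
    (λ m → trans (dilate-double A m) (trans (A≈B m) (sym (dilate-double B m))))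
    (λ m → trans (dilate-odd A m) (sym (dilate-odd B m)))

  evenPart-⊛-dilate : ∀ B A → evenPart (B ⊛ dilate A) ≈ evenPart B ⊛ A
  evenPart-⊛-dilate B A m = begin
    (B ⊛ dilate A) (double m) ≡⟨ ⊛-comm B (dilate A) (double m) ⟩
    (dilate A ⊛ B) (double m) ≡⟨ at-double m A ⟩
    (A ⊛ evenPart B) m        ≡⟨ ⊛-comm A (evenPart B) m ⟩
    (evenPart B ⊛ A) m        ∎
    where
    open ≡-Reasoning
    at-double : ∀ m A → (dilate A ⊛ B) (double m) ≡ (A ⊛ evenPart B) m
    at-double zero    A = refl
    at-double (suc m) A = cong ((A 0 * B (double (suc m))) ⊕_) (at-double m (A ∘ suc))

  oddPart-⊛-dilate : ∀ B A → oddPart (B ⊛ dilate A) ≈ oddPart B ⊛ A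
  oddPart-⊛-dilate B A m = begin
    (B ⊛ dilate A) (suc (double m)) ≡⟨ ⊛-comm B (dilate A) (suc (double m)) ⟩
    (dilate A ⊛ B) (suc (double m)) ≡⟨ at-odd m A ⟩
    (A ⊛ oddPart B) m               ≡⟨ ⊛-comm A (oddPart B) m ⟩
    (oddPart B ⊛ A) m               ∎
    where
    open ≡-Reasoning
    at-odd : ∀ m A → (dilate A ⊛ B) (suc (double m)) ≡ (A ⊛ oddPart B) m
    at-odd zero    A = +-identityʳ _
    at-odd (suc m) A = cong ((A 0 * B (suc (double (suc m)))) ⊕_) (at-odd m (A ∘ suc))

  dilate-⊛ : ∀ A B → dilate (A ⊛ B) ≈ dilate A ⊛ dilate B
  dilate-⊛ A B = evenPart-oddPart-≈
    (λ m → trans (dilate-double (A ⊛ B) m)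
                 (sym (trans (evenPart-⊛-dilate (dilate A) B m) (⊛-cong (dilate-double A) ≈-refl m))))
    (λ m → trans (dilate-odd (A ⊛ B) m)
                 (sym (trans (oddPart-⊛-dilate (dilate A) B m)
                             (antidiagonal-0 m _ (λ i j → cong (_* B j) (dilate-odd A i))))))

  dilate-1ₛ : dilate 1ₛ ≈ 1ₛ
  dilate-1ₛ = evenPart-oddPart-≈ (λ { zero → refl ; (suc m) → dilate-double 1ₛ (suc m) }) (dilate-odd 1ₛ)

  frobenius : ∀ A → A ⊛ A ≈ dilate A
  frobenius A = evenPart-oddPart-≈
    (λ m → trans (antidiagonal-symmetric-double m _ (λ i j → *-comm (A i) (A j)))
                 (trans (*-idem (A m)) (sym (dilate-double A m))))
    (λ m → trans (antidiagonal-symmetric-odd m _ (λ i j → *-comm (A i) (A j))) (sym (dilate-odd A m)))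

  module ⊛-Solver = CommutativeMonoidSolver ⊛-commutativeMonoid

  -- C = C (A C)(q²) = (A C) A C(q²), using A A = A(q²).
  inverse-dilate : ∀ A C → A ⊛ C ≈ 1ₛ → C ≈ A ⊛ dilate C
  inverse-dilate A C AC≈1 = begin
    C                           ≈⟨ ≈-sym (⊛-identityʳ C) ⟩
    C ⊛ 1ₛ                      ≈⟨ ⊛-cong ≈-refl (≈-sym dilate[AC]≈1) ⟩
    C ⊛ dilate (A ⊛ C)          ≈⟨ ⊛-cong ≈-refl (dilate-⊛ A C) ⟩
    C ⊛ (dilate A ⊛ dilate C)   ≈⟨ ⊛-cong ≈-refl (⊛-cong (≈-sym (frobenius A)) ≈-refl) ⟩
    C ⊛ ((A ⊛ A) ⊛ dilate C)    ≈⟨ prove 3 (c ⊹ ((a ⊹ a) ⊹ d)) ((a ⊹ c) ⊹ (a ⊹ d)) (A ∷ C ∷ dilate C ∷ []) ⟩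
    (A ⊛ C) ⊛ (A ⊛ dilate C)    ≈⟨ ⊛-cong AC≈1 ≈-refl ⟩
    1ₛ ⊛ (A ⊛ dilate C)         ≈⟨ ⊛-identityˡ _ ⟩
    A ⊛ dilate C                ∎
    where
    open SetoidReasoning ≈-setoid
    open ⊛-Solver using (prove; var) renaming (_⊕_ to _⊹_)
    a = var 0F
    c = var 1F
    d = var 2F
    dilate[AC]≈1 : dilate (A ⊛ C) ≈ 1ₛ
    dilate[AC]≈1 = ≈-trans (dilate-cong AC≈1) dilate-1ₛ

  evenPart-oddPart-⊛-dilate² : ∀ B A → evenPart (oddPart (B ⊛ dilate (dilate A))) ≈ evenPart (oddPart B) ⊛ A
  evenPart-oddPart-⊛-dilate² B A k =
    trans (oddPart-⊛-dilate B (dilate A) (double k)) (evenPart-⊛-dilate (oddPart B) A k)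

  oddPart-oddPart-⊛-dilate² : ∀ B A → oddPart (oddPart (B ⊛ dilate (dilate A))) ≈ oddPart (oddPart B) ⊛ A
  oddPart-oddPart-⊛-dilate² B A k =
    trans (oddPart-⊛-dilate B (dilate A) (suc (double k))) (oddPart-⊛-dilate (oddPart B) A k)

module Reduction where
  open PowerSeries
  open import Data.Nat.Base as ℕ using (ℕ; zero; suc; _∸_; _≤_; parity)
  import Data.Nat.Properties as ℕₚ
  open import Data.Nat.Properties using (_≟_)
  import Data.Nat.Divisibility as ℕD
  open import Data.Integer.Base as ℤ using (ℤ; +_; -[1+_]; ∣_∣; _⊖_)
  import Data.Integer.Properties as ℤₚ
  open import Data.Integer.Divisibility using (_∣_)
  open import Data.Bool.Base using (if_then_else_)
  open import Data.Parity.Base using (Parity; 0ℙ; 1ℙ; _*_) renaming (_+_ to _⊕_)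
  open import Data.Parity.Properties using (+-comm; *-zeroʳ; +-homo-+; *-homo-*)
  open import Data.Sum.Base using (inj₁; inj₂)
  open import Function.Base using (_∘_)
  open import Function.Bundles using (_⇔_; mk⇔)
  open import Relation.Binary.PropositionalEquality
  open import Relation.Nullary.Decidable.Core using (Dec; yes; no; isYes)

  parityℤ : ℤ → Parity
  parityℤ x = parity ∣ x ∣

  parity-∸ : ∀ {m n} → n ≤ m → parity (m ∸ n) ≡ parity m ⊕ parity n
  parity-∸ {m} {n} n≤m = begin
    parity (m ∸ n)                         ≡⟨ sym (x⊕y⊕y≡x _ (parity n)) ⟩
    (parity (m ∸ n) ⊕ parity n) ⊕ parity n ≡⟨ cong (_⊕ parity n) (sym (+-homo-+ (m ∸ n) n)) ⟩
    parity (m ∸ n ℕ.+ n) ⊕ parity n        ≡⟨ cong (λ k → parity k ⊕ parity n) (ℕₚ.m∸n+n≡m n≤m) ⟩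
    parity m ⊕ parity n                    ∎
    where open ≡-Reasoning

  parityℤ-⊖ : ∀ m n → parityℤ (m ⊖ n) ≡ parity m ⊕ parity n
  parityℤ-⊖ m n with ℕₚ.≤-total m n
  ... | inj₁ m≤n = trans (cong parity (ℤₚ.∣⊖∣-≤ m≤n)) (trans (parity-∸ m≤n) (+-comm (parity n) (parity m)))
  ... | inj₂ n≤m = trans (cong parity (trans (ℤₚ.∣m⊖n∣≡∣n⊖m∣ m n) (ℤₚ.∣⊖∣-≤ n≤m))) (parity-∸ n≤m)

  parityℤ-+ : ∀ x y → parityℤ (x ℤ.+ y) ≡ parityℤ x ⊕ parityℤ y
  parityℤ-+ (+ m)    (+ n)    = +-homo-+ m n
  parityℤ-+ (+ m)    -[1+ n ] = parityℤ-⊖ m (suc n)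
  parityℤ-+ -[1+ m ] (+ n)    = trans (parityℤ-⊖ n (suc m)) (+-comm (parity n) _)
  parityℤ-+ -[1+ m ] -[1+ n ] = trans (cong (parity ∘ suc) (sym (ℕₚ.+-suc m n))) (+-homo-+ (suc m) (suc n))

  parityℤ-neg : ∀ x → parityℤ (ℤ.- x) ≡ parityℤ x
  parityℤ-neg x = cong parity (ℤₚ.∣-i∣≡∣i∣ x)

  parityℤ-* : ∀ x y → parityℤ (x ℤ.* y) ≡ parityℤ x * parityℤ y
  parityℤ-* x y = trans (cong parity (ℤₚ.abs-* x y)) (*-homo-* ∣ x ∣ ∣ y ∣)

  parityℤ≡0ℙ⇔2∣ : ∀ x → parityℤ x ≡ 0ℙ ⇔ + 2 ∣ x
  parityℤ≡0ℙ⇔2∣ x = mk⇔ (even⇒2∣ ∣ x ∣) 2∣⇒even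
    where
    even⇒2∣ : ∀ n → parity n ≡ 0ℙ → 2 ℕD.∣ n
    even⇒2∣ zero          _    = 2 ℕD.∣0
    even⇒2∣ (suc (suc n)) even = ℕD.∣m∣n⇒∣m+n (ℕD.∣-refl {2}) (even⇒2∣ n even)
    2∣⇒even : + 2 ∣ x → parity ∣ x ∣ ≡ 0ℙ
    2∣⇒even (ℕD.divides q ∣x∣≡q*2) = trans (cong parity ∣x∣≡q*2) (trans (*-homo-* q 2) (*-zeroʳ (parity q)))

  parityℤ-negOnePow : ∀ t → parityℤ (negOnePow t) ≡ 1ℙ
  parityℤ-negOnePow zero    = refl
  parityℤ-negOnePow (suc t) = trans (parityℤ-neg (negOnePow t)) (parityℤ-negOnePow t)

  parityℤ-ifExp : ∀ e N {v} → parityℤ v ≡ 1ℙ → parityℤ (ifExp e N v) ≡ 𝟙 (e ≟ N)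
  parityℤ-ifExp e N {v} v-odd = guarded (e ≟ N)
    where
    guarded : ∀ {P : Set} (p : Dec P) → parityℤ (if isYes p then v else + 0) ≡ 𝟙 p
    guarded (yes _) = v-odd
    guarded (no _)  = refl

  reduce : (ℕ → ℤ) → Series
  reduce a n = parityℤ (a n)

  parityℤ-Σ< : ∀ n f → parityℤ (Σ< n f) ≡ ∑< n (parityℤ ∘ f)
  parityℤ-Σ< zero    f = refl
  parityℤ-Σ< (suc n) f = trans (parityℤ-+ (Σ< n f) (f n)) (cong (_⊕ parityℤ (f n)) (parityℤ-Σ< n f))

  reduce-conv : ∀ a b → reduce (conv a b) ≈ reduce a ⊛ reduce b
  reduce-conv a b N = begin
    parityℤ (Σ< (suc N) (λ i → a i ℤ.* b (N ∸ i)))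
      ≡⟨ parityℤ-Σ< (suc N) _ ⟩
    ∑< (suc N) (λ i → parityℤ (a i ℤ.* b (N ∸ i)))
      ≡⟨ ∑<-cong (suc N) (λ i _ → parityℤ-* (a i) (b (N ∸ i))) ⟩
    ∑< (suc N) (λ i → reduce a i * reduce b (N ∸ i))
      ≡⟨ ∑<-antidiagonal N (λ i j → reduce a i * reduce b j) ⟩
    (reduce a ⊛ reduce b) N ∎
    where open ≡-Reasoning

  reduce-one : reduce one ≈ 1ₛ
  reduce-one zero    = refl
  reduce-one (suc n) = refl

  IsC⇒reduce-inverse : ∀ {r s c} → IsC r s c → reduce (psiCoeff r s) ⊛ reduce c ≈ 1ₛ
  IsC⇒reduce-inverse {r} {s} {c} isC N =
    trans (sym (reduce-conv (psiCoeff r s) c N)) (trans (cong parityℤ (isC N)) (reduce-one N))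

module ThetaSeries where
  open PowerSeries
  open import Data.Nat.Base as ℕ using (ℕ; zero; suc; _≤_; _<_; _⊔_; s≤s)
  import Data.Nat.Properties as ℕₚ
  open import Data.Nat.Properties using (_≟_)
  open import Data.Integer.Base using (ℤ; +_; -[1+_]; ∣_∣)
  import Data.Integer.Properties as ℤₚ
  open import Data.Parity.Base using (Parity; 0ℙ; 1ℙ; _*_) renaming (_+_ to _⊕_)
  open import Data.Parity.Properties
    using (+-identityʳ; *-comm; *-identityʳ; *-distribˡ-+; +-commutativeSemigroup)
  open import Algebra.Properties.CommutativeSemigroup +-commutativeSemigroup using (interchange)
  open import Data.Product.Base using (∃; _×_; _,_)
  open import Data.Product.Properties using (≡-dec; ,-injectiveˡ; ,-injectiveʳ)
  open import Function.Base using (_∘_)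
  open import Relation.Binary.Definitions using (DecidableEquality)
  open import Relation.Binary.PropositionalEquality
  open import Relation.Nullary.Decidable.Core using (_×-dec_)

  ∑ℤ : ℕ → (ℤ → Parity) → Parity
  ∑ℤ M f = ∑< (suc M) (f ∘ +_) ⊕ ∑< M (f ∘ -[1+_])

  ∑ℤ-cong : ∀ M {f g : ℤ → Parity} → (∀ x → f x ≡ g x) → ∑ℤ M f ≡ ∑ℤ M g
  ∑ℤ-cong M f≗g = cong₂ _⊕_ (∑<-cong (suc M) (λ i _ → f≗g (+ i))) (∑<-cong M (λ i _ → f≗g -[1+ i ]))

  ∑ℤ-0 : ∀ M (f : ℤ → Parity) → (∀ x → f x ≡ 0ℙ) → ∑ℤ M f ≡ 0ℙ
  ∑ℤ-0 M f f≗0 = cong₂ _⊕_ (∑<-0 (suc M) _ (λ i _ → f≗0 (+ i))) (∑<-0 M _ (λ i _ → f≗0 -[1+ i ]))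

  ∑ℤ-+ : ∀ M (f g : ℤ → Parity) → ∑ℤ M (λ x → f x ⊕ g x) ≡ ∑ℤ M f ⊕ ∑ℤ M g
  ∑ℤ-+ M f g = trans (cong₂ _⊕_ (∑<-+ (suc M) (f ∘ +_) (g ∘ +_)) (∑<-+ M (f ∘ -[1+_]) (g ∘ -[1+_])))
                     (interchange (∑< (suc M) (f ∘ +_)) (∑< (suc M) (g ∘ +_)) _ _)

  ∑ℤ-*ˡ : ∀ M a (f : ℤ → Parity) → a * ∑ℤ M f ≡ ∑ℤ M (λ x → a * f x)
  ∑ℤ-*ˡ M a f = trans (*-distribˡ-+ a _ _) (cong₂ _⊕_ (∑<-*ˡ (suc M) a _) (∑<-*ˡ M a _))

  ∑ℤ-*ʳ : ∀ M a (f : ℤ → Parity) → ∑ℤ M f * a ≡ ∑ℤ M (λ x → f x * a)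
  ∑ℤ-*ʳ M a f = trans (*-comm _ a) (trans (∑ℤ-*ˡ M a f) (∑ℤ-cong M (λ x → *-comm a (f x))))

  ∑<-∑ℤ-comm : ∀ n M (f : ℕ → ℤ → Parity) →
               ∑< n (λ i → ∑ℤ M (f i)) ≡ ∑ℤ M (λ x → ∑< n (λ i → f i x))
  ∑<-∑ℤ-comm n M f = trans (∑<-+ n _ _) (cong₂ _⊕_ (∑<-comm n (suc M) _) (∑<-comm n M _))

  ∑ℤ-comm : ∀ M M′ (f : ℤ → ℤ → Parity) →
            ∑ℤ M (λ x → ∑ℤ M′ (f x)) ≡ ∑ℤ M′ (λ y → ∑ℤ M (λ x → f x y))
  ∑ℤ-comm M M′ f = trans (∑ℤ-+ M (λ x → ∑< (suc M′) (f x ∘ +_)) (λ x → ∑< M′ (f x ∘ -[1+_])))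
    (cong₂ _⊕_ (sym (∑<-∑ℤ-comm (suc M′) M (λ j x → f x (+ j)))) (sym (∑<-∑ℤ-comm M′ M (λ j x → f x -[1+ j ]))))

  antidiagonal-∑ℤ : ∀ N M (f : ℤ → ℕ → ℕ → Parity) →
                    antidiagonal N (λ i j → ∑ℤ M (λ x → f x i j)) ≡ ∑ℤ M (λ x → antidiagonal N (f x))
  antidiagonal-∑ℤ zero    M f = refl
  antidiagonal-∑ℤ (suc N) M f =
    trans (cong (λ s → ∑ℤ M (λ x → f x 0 (suc N)) ⊕ s) (antidiagonal-∑ℤ N M (λ x i j → f x (suc i) j)))
          (sym (∑ℤ-+ M (λ x → f x 0 (suc N)) (λ x → antidiagonal N (λ i j → f x (suc i) j))))

  ∑ℤ-δ : ∀ M a → ∣ a ∣ ≤ M → ∑ℤ M (λ x → 𝟙 (x ℤₚ.≟ a)) ≡ 1ℙ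
  ∑ℤ-δ M (+ n) n≤M = begin
    ∑< (suc M) (λ i → 𝟙 (+ i ℤₚ.≟ + n)) ⊕ ∑< M (λ i → 𝟙 (-[1+ i ] ℤₚ.≟ + n))
      ≡⟨ cong₂ _⊕_ (∑<-cong (suc M) (λ i _ → 𝟙-⇔ (+ i ℤₚ.≟ + n) (i ≟ n) ℤₚ.+-injective (cong +_)))
                   (∑<-0 M _ (λ i _ → 𝟙-no (-[1+ i ] ℤₚ.≟ + n) λ ())) ⟩
    ∑< (suc M) (λ i → 𝟙 (i ≟ n)) ⊕ 0ℙ
      ≡⟨ cong (_⊕ 0ℙ) (∑<-δ (suc M) n (s≤s n≤M)) ⟩
    1ℙ ∎
    where open ≡-Reasoning
  ∑ℤ-δ M -[1+ n ] n<M = begin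
    ∑< (suc M) (λ i → 𝟙 (+ i ℤₚ.≟ -[1+ n ])) ⊕ ∑< M (λ i → 𝟙 (-[1+ i ] ℤₚ.≟ -[1+ n ]))
      ≡⟨ cong₂ _⊕_ (∑<-0 (suc M) _ (λ i _ → 𝟙-no (+ i ℤₚ.≟ -[1+ n ]) λ ()))
                   (∑<-cong M (λ i _ → 𝟙-⇔ (-[1+ i ] ℤₚ.≟ -[1+ n ]) (i ≟ n) ℤₚ.-[1+-injective (cong -[1+_]))) ⟩
    0ℙ ⊕ ∑< M (λ i → 𝟙 (i ≟ n))
      ≡⟨ ∑<-δ M n n<M ⟩
    1ℙ ∎
    where open ≡-Reasoning

  ∑ℤ-extend : ∀ {M M′} (f : ℤ → Parity) → M ≤ M′ → (∀ x → M < ∣ x ∣ → f x ≡ 0ℙ) →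
              ∑ℤ M′ f ≡ ∑ℤ M f
  ∑ℤ-extend f M≤M′ outside≡0 = cong₂ _⊕_
    (∑<-extend (f ∘ +_) (s≤s M≤M′) (λ i M<i _ → outside≡0 (+ i) M<i))
    (∑<-extend (f ∘ -[1+_]) M≤M′ (λ i M≤i _ → outside≡0 -[1+ i ] (s≤s M≤i)))

  ∑ℤ-witness : ∀ M (f : ℤ → Parity) → ∑ℤ M f ≡ 1ℙ → ∃ λ x → ∣ x ∣ ≤ M × f x ≡ 1ℙ
  ∑ℤ-witness M f sum≡1 with ∑< (suc M) (f ∘ +_) in nonneg≡
  ... | 1ℙ = let (i , i<1+M , fi≡1) = ∑<-witness (suc M) (f ∘ +_) nonneg≡ in + i , ℕₚ.≤-pred i<1+M , fi≡1
  ... | 0ℙ = let (i , i<M , fi≡1) = ∑<-witness M (f ∘ -[1+_]) sum≡1 in -[1+ i ] , i<M , fi≡1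

  ℤ² : Set
  ℤ² = ℤ × ℤ

  ∥_∥ : ℤ² → ℕ
  ∥ x , y ∥ = ∣ x ∣ ⊔ ∣ y ∣

  _≟²_ : DecidableEquality ℤ²
  _≟²_ = ≡-dec ℤₚ._≟_ ℤₚ._≟_

  ∑ℤ² : ℕ → (ℤ² → Parity) → Parity
  ∑ℤ² M f = ∑ℤ M (λ x → ∑ℤ M (λ y → f (x , y)))

  ∑ℤ²-cong : ∀ M {f g : ℤ² → Parity} → (∀ z → f z ≡ g z) → ∑ℤ² M f ≡ ∑ℤ² M g
  ∑ℤ²-cong M f≗g = ∑ℤ-cong M (λ x → ∑ℤ-cong M (λ y → f≗g (x , y)))

  ∑ℤ²-0 : ∀ M (f : ℤ² → Parity) → (∀ z → f z ≡ 0ℙ) → ∑ℤ² M f ≡ 0ℙ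
  ∑ℤ²-0 M f f≗0 =
    ∑ℤ-0 M (λ x → ∑ℤ M (λ y → f (x , y))) (λ x → ∑ℤ-0 M (λ y → f (x , y)) (λ y → f≗0 (x , y)))

  ∑ℤ²-*ˡ : ∀ M a (f : ℤ² → Parity) → a * ∑ℤ² M f ≡ ∑ℤ² M (λ z → a * f z)
  ∑ℤ²-*ˡ M a f =
    trans (∑ℤ-*ˡ M a (λ x → ∑ℤ M (λ y → f (x , y)))) (∑ℤ-cong M (λ x → ∑ℤ-*ˡ M a (λ y → f (x , y))))

  ∑ℤ²-comm : ∀ M M′ (f : ℤ² → ℤ² → Parity) →
             ∑ℤ² M (λ z → ∑ℤ² M′ (f z)) ≡ ∑ℤ² M′ (λ w → ∑ℤ² M (λ z → f z w))
  ∑ℤ²-comm M M′ f = begin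
    ∑ℤ M (λ x → ∑ℤ M (λ y → ∑ℤ M′ (λ x′ → ∑ℤ M′ (λ y′ → f (x , y) (x′ , y′)))))
      ≡⟨ ∑ℤ-cong M (λ x → ∑ℤ-comm M M′ (λ y x′ → ∑ℤ M′ (λ y′ → f (x , y) (x′ , y′)))) ⟩
    ∑ℤ M (λ x → ∑ℤ M′ (λ x′ → ∑ℤ M (λ y → ∑ℤ M′ (λ y′ → f (x , y) (x′ , y′)))))
      ≡⟨ ∑ℤ-comm M M′ (λ x x′ → ∑ℤ M (λ y → ∑ℤ M′ (λ y′ → f (x , y) (x′ , y′)))) ⟩
    ∑ℤ M′ (λ x′ → ∑ℤ M (λ x → ∑ℤ M (λ y → ∑ℤ M′ (λ y′ → f (x , y) (x′ , y′)))))
      ≡⟨ ∑ℤ-cong M′ (λ x′ → ∑ℤ-cong M (λ x → ∑ℤ-comm M M′ (λ y y′ → f (x , y) (x′ , y′)))) ⟩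
    ∑ℤ M′ (λ x′ → ∑ℤ M (λ x → ∑ℤ M′ (λ y′ → ∑ℤ M (λ y → f (x , y) (x′ , y′)))))
      ≡⟨ ∑ℤ-cong M′ (λ x′ → ∑ℤ-comm M M′ (λ x y′ → ∑ℤ M (λ y → f (x , y) (x′ , y′)))) ⟩
    ∑ℤ M′ (λ x′ → ∑ℤ M′ (λ y′ → ∑ℤ M (λ x → ∑ℤ M (λ y → f (x , y) (x′ , y′))))) ∎
    where open ≡-Reasoning

  antidiagonal-∑ℤ² : ∀ N M (f : ℤ² → ℕ → ℕ → Parity) →
                     antidiagonal N (λ i j → ∑ℤ² M (λ z → f z i j)) ≡ ∑ℤ² M (λ z → antidiagonal N (f z))
  antidiagonal-∑ℤ² N M f = trans (antidiagonal-∑ℤ N M (λ x i j → ∑ℤ M (λ y → f (x , y) i j)))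
                                  (∑ℤ-cong M (λ x → antidiagonal-∑ℤ N M (λ y → f (x , y))))

  ∑ℤ²-δ : ∀ M a → ∥ a ∥ ≤ M → ∑ℤ² M (λ z → 𝟙 (z ≟² a)) ≡ 1ℙ
  ∑ℤ²-δ M (a , b) ∥a,b∥≤M = begin
    ∑ℤ M (λ x → ∑ℤ M (λ y → 𝟙 ((x , y) ≟² (a , b))))
      ≡⟨ ∑ℤ-cong M (λ x → ∑ℤ-cong M (λ y → δ-split x y)) ⟩
    ∑ℤ M (λ x → ∑ℤ M (λ y → 𝟙 (x ℤₚ.≟ a) * 𝟙 (y ℤₚ.≟ b)))
      ≡⟨ ∑ℤ-cong M (λ x → sym (∑ℤ-*ˡ M (𝟙 (x ℤₚ.≟ a)) (λ y → 𝟙 (y ℤₚ.≟ b)))) ⟩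
    ∑ℤ M (λ x → 𝟙 (x ℤₚ.≟ a) * ∑ℤ M (λ y → 𝟙 (y ℤₚ.≟ b)))
      ≡⟨ ∑ℤ-cong M (λ x → trans (cong (𝟙 (x ℤₚ.≟ a) *_) (∑ℤ-δ M b (ℕₚ.m⊔n≤o⇒n≤o ∣ a ∣ ∣ b ∣ ∥a,b∥≤M)))
                                (*-identityʳ _)) ⟩
    ∑ℤ M (λ x → 𝟙 (x ℤₚ.≟ a))
      ≡⟨ ∑ℤ-δ M a (ℕₚ.m⊔n≤o⇒m≤o ∣ a ∣ ∣ b ∣ ∥a,b∥≤M) ⟩
    1ℙ ∎
    where
    open ≡-Reasoning
    δ-split : ∀ x y → 𝟙 ((x , y) ≟² (a , b)) ≡ 𝟙 (x ℤₚ.≟ a) * 𝟙 (y ℤₚ.≟ b)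
    δ-split x y = trans (𝟙-⇔ ((x , y) ≟² (a , b)) ((x ℤₚ.≟ a) ×-dec (y ℤₚ.≟ b))
                             (λ eq → ,-injectiveˡ eq , ,-injectiveʳ eq) (λ { (refl , refl) → refl }))
                        (sym (𝟙-× (x ℤₚ.≟ a) (y ℤₚ.≟ b)))

  ∑ℤ²-extend : ∀ {M M′} (f : ℤ² → Parity) → M ≤ M′ → (∀ z → M < ∥ z ∥ → f z ≡ 0ℙ) →
               ∑ℤ² M′ f ≡ ∑ℤ² M f
  ∑ℤ²-extend {M} {M′} f M≤M′ outside≡0 = begin
    ∑ℤ M′ (λ x → ∑ℤ M′ (λ y → f (x , y)))
      ≡⟨ ∑ℤ-extend (λ x → ∑ℤ M′ (λ y → f (x , y))) M≤M′ (λ x M<∣x∣ → ∑ℤ-0 M′ (λ y → f (x , y)) (λ y →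
           outside≡0 (x , y) (ℕₚ.<-≤-trans M<∣x∣ (ℕₚ.m≤m⊔n ∣ x ∣ ∣ y ∣)))) ⟩
    ∑ℤ M (λ x → ∑ℤ M′ (λ y → f (x , y)))
      ≡⟨ ∑ℤ-cong M (λ x → ∑ℤ-extend (λ y → f (x , y)) M≤M′ (λ y M<∣y∣ →
           outside≡0 (x , y) (ℕₚ.<-≤-trans M<∣y∣ (ℕₚ.m≤n⊔m ∣ x ∣ ∣ y ∣)))) ⟩
    ∑ℤ M (λ x → ∑ℤ M (λ y → f (x , y))) ∎
    where open ≡-Reasoning

  Coercive : (ℤ → ℕ) → Set
  Coercive e = ∀ x → ∣ x ∣ ≤ e x

  Coercive² : (ℤ² → ℕ) → Set
  Coercive² E = ∀ z → ∥ z ∥ ≤ E z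

  -- θ e = ∑ over x ∈ ℤ of q^(e x); for coercive e only ∣ x ∣ ≤ N can contribute to the coefficient of q^N.
  θ : (ℤ → ℕ) → Series
  θ e N = ∑ℤ N (λ x → 𝟙 (e x ≟ N))

  θ² : (ℤ² → ℕ) → Series
  θ² E N = ∑ℤ² N (λ z → 𝟙 (E z ≟ N))

  θ-extend : ∀ {e} → Coercive e → ∀ {n M} → n ≤ M → θ e n ≡ ∑ℤ M (λ x → 𝟙 (e x ≟ n))
  θ-extend {e} coercive n≤M = sym (∑ℤ-extend _ n≤M (λ x n<∣x∣ → 𝟙-no (e x ≟ _)
    (λ ex≡n → ℕₚ.<⇒≱ n<∣x∣ (subst (∣ x ∣ ≤_) ex≡n (coercive x)))))

  θ²-extend : ∀ {E} → Coercive² E → ∀ {n M} → n ≤ M → θ² E n ≡ ∑ℤ² M (λ z → 𝟙 (E z ≟ n))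
  θ²-extend {E} coercive n≤M = sym (∑ℤ²-extend _ n≤M (λ z n<∥z∥ → 𝟙-no (E z ≟ _)
    (λ Ez≡n → ℕₚ.<⇒≱ n<∥z∥ (subst (∥ z ∥ ≤_) Ez≡n (coercive z)))))

  antidiagonal-δ : ∀ N a b → antidiagonal N (λ i j → 𝟙 (a ≟ i) * 𝟙 (b ≟ j)) ≡ 𝟙 (a ℕ.+ b ≟ N)
  antidiagonal-δ zero    zero    b = refl
  antidiagonal-δ zero    (suc a) b = refl
  antidiagonal-δ (suc N) zero    b =
    trans (cong (𝟙 (b ≟ suc N) ⊕_) (antidiagonal-0 N _ (λ _ _ → refl))) (+-identityʳ _)
  antidiagonal-δ (suc N) (suc a) b = antidiagonal-δ N a b

  Coercive²-+ : ∀ {e f} → Coercive e → Coercive f → Coercive² (λ (x , y) → e x ℕ.+ f y)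
  Coercive²-+ {e} {f} coercive-e coercive-f (x , y) = ℕₚ.⊔-lub
    (ℕₚ.≤-trans (coercive-e x) (ℕₚ.m≤m+n (e x) (f y)))
    (ℕₚ.≤-trans (coercive-f y) (ℕₚ.m≤n+m (f y) (e x)))

  θ-⊛ : ∀ {e f} → Coercive e → Coercive f → θ e ⊛ θ f ≈ θ² (λ (x , y) → e x ℕ.+ f y)
  θ-⊛ {e} {f} coercive-e coercive-f N = begin
    antidiagonal N (λ i j → θ e i * θ f j)
      ≡⟨ antidiagonal-cong N (λ i j i+j≡N → cong₂ _*_
           (θ-extend coercive-e (subst (i ≤_) i+j≡N (ℕₚ.m≤m+n i j)))
           (θ-extend coercive-f (subst (j ≤_) i+j≡N (ℕₚ.m≤n+m j i)))) ⟩
    antidiagonal N (λ i j → ∑ℤ N (λ x → 𝟙 (e x ≟ i)) * ∑ℤ N (λ y → 𝟙 (f y ≟ j)))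
      ≡⟨ antidiagonal-cong N (λ i j _ → trans (∑ℤ-*ʳ N (∑ℤ N (λ y → 𝟙 (f y ≟ j))) (λ x → 𝟙 (e x ≟ i)))
                                              (∑ℤ-cong N (λ x → ∑ℤ-*ˡ N (𝟙 (e x ≟ i)) (λ y → 𝟙 (f y ≟ j))))) ⟩
    antidiagonal N (λ i j → ∑ℤ² N (λ (x , y) → 𝟙 (e x ≟ i) * 𝟙 (f y ≟ j)))
      ≡⟨ antidiagonal-∑ℤ² N N (λ (x , y) i j → 𝟙 (e x ≟ i) * 𝟙 (f y ≟ j)) ⟩
    ∑ℤ² N (λ (x , y) → antidiagonal N (λ i j → 𝟙 (e x ≟ i) * 𝟙 (f y ≟ j)))
      ≡⟨ ∑ℤ²-cong N (λ (x , y) → antidiagonal-δ N (e x) (f y)) ⟩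
    θ² (λ (x , y) → e x ℕ.+ f y) N ∎
    where open ≡-Reasoning

  q^_ : ℕ → Series
  (q^ c) n = 𝟙 (c ≟ n)

  q^-⊛-θ² : ∀ c {E} → Coercive² E → q^ c ⊛ θ² E ≈ θ² (λ z → c ℕ.+ E z)
  q^-⊛-θ² c {E} coercive N = begin
    antidiagonal N (λ i j → 𝟙 (c ≟ i) * θ² E j)
      ≡⟨ antidiagonal-cong N (λ i j i+j≡N → cong (𝟙 (c ≟ i) *_)
           (θ²-extend coercive (subst (j ≤_) i+j≡N (ℕₚ.m≤n+m j i)))) ⟩
    antidiagonal N (λ i j → 𝟙 (c ≟ i) * ∑ℤ² N (λ z → 𝟙 (E z ≟ j)))
      ≡⟨ antidiagonal-cong N (λ i j _ → ∑ℤ²-*ˡ N (𝟙 (c ≟ i)) (λ z → 𝟙 (E z ≟ j))) ⟩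
    antidiagonal N (λ i j → ∑ℤ² N (λ z → 𝟙 (c ≟ i) * 𝟙 (E z ≟ j)))
      ≡⟨ antidiagonal-∑ℤ² N N (λ z i j → 𝟙 (c ≟ i) * 𝟙 (E z ≟ j)) ⟩
    ∑ℤ² N (λ z → antidiagonal N (λ i j → 𝟙 (c ≟ i) * 𝟙 (E z ≟ j)))
      ≡⟨ ∑ℤ²-cong N (λ z → antidiagonal-δ N c (E z)) ⟩
    θ² (λ z → c ℕ.+ E z) N ∎
    where open ≡-Reasoning

  q^-⊛-shift : ∀ c A N → (q^ c ⊛ A) (c ℕ.+ N) ≡ A N
  q^-⊛-shift zero    A N = trans (⊛-cong {B = A} (λ { zero → refl ; (suc _) → refl }) ≈-refl N) (⊛-identityˡ A N)
  q^-⊛-shift (suc c) A N = q^-⊛-shift c A N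

  Coercive-double : ∀ {e} → Coercive e → Coercive (double ∘ e)
  Coercive-double {e} coercive x = ℕₚ.≤-trans (coercive x) (n≤double (e x))

  dilate-θ : ∀ {e} → Coercive e → dilate (θ e) ≈ θ (double ∘ e)
  dilate-θ {e} coercive = evenPart-oddPart-≈
    (λ m → begin
      dilate (θ e) (double m)            ≡⟨ dilate-double (θ e) m ⟩
      θ e m                              ≡⟨ θ-extend coercive (n≤double m) ⟩
      ∑ℤ (double m) (λ x → 𝟙 (e x ≟ m))  ≡⟨ ∑ℤ-cong (double m) (λ x → 𝟙-⇔ (e x ≟ m) (double (e x) ≟ double m)
                                                                      (cong double) double-injective) ⟩
      θ (double ∘ e) (double m)          ∎)
    (λ m → trans (dilate-odd (θ e) m) (sym (∑ℤ-0 (suc (double m)) _ (λ x →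
      𝟙-no (double (e x) ≟ suc (double m)) (double≢suc-double (e x) m)))))
    where open ≡-Reasoning

  -- Both sides equal the double sum over z and w of [E′ z = N′]·[w = φ z].
  θ²-bijection : ∀ {E E′ : ℤ² → ℕ} {N N′} (φ : ℤ² → ℤ²) → Coercive² E → Coercive² E′ →
                 (∀ z → E′ z ≡ N′ → E (φ z) ≡ N) →
                 (∀ w → E w ≡ N → ∃ λ z → E′ z ≡ N′ × φ z ≡ w) →
                 (∀ {z z′} → φ z ≡ φ z′ → z ≡ z′) →
                 θ² E N ≡ θ² E′ N′
  θ²-bijection {E} {E′} {N} {N′} φ coercive coercive′ maps-to onto injective = begin
    ∑ℤ² N (λ w → 𝟙 (E w ≟ N))
      ≡⟨ ∑ℤ²-cong N fibre-count ⟨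
    ∑ℤ² N (λ w → ∑ℤ² N′ (λ z → incidence z w))
      ≡⟨ ∑ℤ²-comm N N′ (λ w z → incidence z w) ⟩
    ∑ℤ² N′ (λ z → ∑ℤ² N (incidence z))
      ≡⟨ ∑ℤ²-cong N′ (λ z → ∑ℤ²-*ˡ N (𝟙 (E′ z ≟ N′)) (λ w → 𝟙 (w ≟² φ z))) ⟨
    ∑ℤ² N′ (λ z → 𝟙 (E′ z ≟ N′) * ∑ℤ² N (λ w → 𝟙 (w ≟² φ z)))
      ≡⟨ ∑ℤ²-cong N′ image-count ⟩
    ∑ℤ² N′ (λ z → 𝟙 (E′ z ≟ N′)) ∎
    where
    open ≡-Reasoning
    incidence : ℤ² → ℤ² → Parity
    incidence z w = 𝟙 (E′ z ≟ N′) * 𝟙 (w ≟² φ z)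
    image-count : ∀ z → 𝟙 (E′ z ≟ N′) * ∑ℤ² N (λ w → 𝟙 (w ≟² φ z)) ≡ 𝟙 (E′ z ≟ N′)
    image-count z = 𝟙-*-guard (E′ z ≟ N′) (λ E′z≡N′ →
      ∑ℤ²-δ N (φ z) (subst (∥ φ z ∥ ≤_) (maps-to z E′z≡N′) (coercive (φ z))))
    fibre-count : ∀ w → ∑ℤ² N′ (λ z → incidence z w) ≡ 𝟙 (E w ≟ N)
    fibre-count w = 𝟙-elim (E w ≟ N) unique-preimage no-preimage
      where
      unique-preimage : E w ≡ N → ∑ℤ² N′ (λ z → incidence z w) ≡ 1ℙ
      unique-preimage Ew≡N = let (z₀ , E′z₀≡N′ , φz₀≡w) = onto w Ew≡N in begin
        ∑ℤ² N′ (λ z → incidence z w)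
          ≡⟨ ∑ℤ²-cong N′ (λ z → trans (𝟙-× (E′ z ≟ N′) (w ≟² φ z))
               (𝟙-⇔ ((E′ z ≟ N′) ×-dec (w ≟² φ z)) (z ≟² z₀)
               (λ (_ , w≡φz) → injective (trans (sym w≡φz) (sym φz₀≡w)))
               (λ { refl → E′z₀≡N′ , sym φz₀≡w }))) ⟩
        ∑ℤ² N′ (λ z → 𝟙 (z ≟² z₀))
          ≡⟨ ∑ℤ²-δ N′ z₀ (subst (∥ z₀ ∥ ≤_) E′z₀≡N′ (coercive′ z₀)) ⟩
        1ℙ ∎
      no-preimage : E w ≢ N → ∑ℤ² N′ (λ z → incidence z w) ≡ 0ℙ
      no-preimage Ew≢N = ∑ℤ²-0 N′ (λ z → incidence z w) (λ z → trans (𝟙-× (E′ z ≟ N′) (w ≟² φ z))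
        (𝟙-no ((E′ z ≟ N′) ×-dec (w ≟² φ z))
              (λ (E′z≡N′ , w≡φz) → Ew≢N (subst (λ v → E v ≡ N) (sym w≡φz) (maps-to z E′z≡N′)))))

  θ²-affine : ∀ {E E′ : ℤ² → ℕ} c d {N′} .{{_ : ℕ.NonZero c}} (φ : ℤ² → ℤ²) →
              Coercive² E → Coercive² E′ →
              (∀ z → E (φ z) ≡ c ℕ.* E′ z ℕ.+ d) →
              (∀ w → E w ≡ c ℕ.* N′ ℕ.+ d → ∃ λ z → φ z ≡ w) →
              (∀ {z z′} → φ z ≡ φ z′ → z ≡ z′) →
              θ² E (c ℕ.* N′ ℕ.+ d) ≡ θ² E′ N′
  θ²-affine {E} {E′} c d {N′} φ coercive coercive′ E∘φ onto injective =
    θ²-bijection φ coercive coercive′ maps-to preimage injective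
    where
    maps-to : ∀ z → E′ z ≡ N′ → E (φ z) ≡ c ℕ.* N′ ℕ.+ d
    maps-to z E′z≡N′ = trans (E∘φ z) (cong (λ n → c ℕ.* n ℕ.+ d) E′z≡N′)
    preimage : ∀ w → E w ≡ c ℕ.* N′ ℕ.+ d → ∃ λ z → E′ z ≡ N′ × φ z ≡ w
    preimage w Ew≡N = let (z , φz≡w) = onto w Ew≡N in
      z , ℕₚ.*-cancelˡ-≡ (E′ z) N′ c (ℕₚ.+-cancelʳ-≡ d _ _ (trans (sym (E∘φ z)) (trans (cong E φz≡w) Ew≡N)))
        , φz≡w

  θ²-≡0ℙ : ∀ {E N} → (∀ z → E z ≢ N) → θ² E N ≡ 0ℙ
  θ²-≡0ℙ {E} {N} E≢N = ∑ℤ²-0 N (λ z → 𝟙 (E z ≟ N)) (λ z → 𝟙-no (E z ≟ N) (E≢N z))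

module Exponents where
  open PowerSeries
  open Reduction
  open ThetaSeries
  open import Data.Nat.Base as ℕ using (ℕ; zero; suc; _∸_; _≤_; parity)
  import Data.Nat.Properties as ℕₚ
  open import Data.Nat.Properties using (_≟_)
  import Data.Nat.Tactic.RingSolver as ℕ-Solver
  open import Data.Integer.Base as ℤ using (ℤ; +_; -[1+_]; ∣_∣; _+_; _*_; -_; _-_)
  import Data.Integer.Properties as ℤₚ
  import Data.Integer.DivMod as ℤDivMod
  open import Data.Integer.Tactic.RingSolver using (solve-∀)
  open import Data.Parity.Base as ℙ using (0ℙ; 1ℙ) renaming (_+_ to _⊕_)
  import Data.Parity.Properties as ℙₚ
  open import Function.Bundles using (_⇔_; mk⇔)
  open import Data.Product.Base using (∃; _,_; proj₁; proj₂)
  open import Data.Product.Properties using (,-injectiveˡ; ,-injectiveʳ)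
  open import Data.Sum.Base using (inj₁; inj₂)
  open import Data.Empty using (⊥-elim)
  open import Relation.Binary.PropositionalEquality
  open import Data.Sum.Base using (_⊎_)

  -- The exponent of q in the term of Ψ(-q^r, q^s) of index n ∈ ℤ, where -[1+ j ] stands for n = -1-j.
  psiExponent : ℕ → ℕ → ℤ → ℕ
  psiExponent r s (+ n)    = r ℕ.* tri n ℕ.+ s ℕ.* (tri n ∸ n)
  psiExponent r s -[1+ j ] = r ℕ.* (tri (suc j) ∸ suc j) ℕ.+ s ℕ.* tri (suc j)

  reduce-psiCoeff : ∀ r s → reduce (psiCoeff r s) ≈ θ (psiExponent r s)
  reduce-psiCoeff r s N = begin
    parityℤ (Σ< (suc N) nonneg - Σ< N neg)
      ≡⟨ parityℤ-+ (Σ< (suc N) nonneg) (- Σ< N neg) ⟩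
    parityℤ (Σ< (suc N) nonneg) ⊕ parityℤ (- Σ< N neg)
      ≡⟨ cong (parityℤ (Σ< (suc N) nonneg) ⊕_) (parityℤ-neg (Σ< N neg)) ⟩
    parityℤ (Σ< (suc N) nonneg) ⊕ parityℤ (Σ< N neg)
      ≡⟨ cong₂ _⊕_ (trans (parityℤ-Σ< (suc N) nonneg) (∑<-cong (suc N) (λ n _ →
                     parityℤ-ifExp (psiExponent r s (+ n)) N (parityℤ-negOnePow (tri n)))))
                   (trans (parityℤ-Σ< N neg) (∑<-cong N (λ j _ →
                     parityℤ-ifExp (psiExponent r s -[1+ j ]) N (parityℤ-negOnePow (tri (suc j) ∸ suc j))))) ⟩
    θ (psiExponent r s) N ∎
    where
    open ≡-Reasoning
    nonneg neg : ℕ → ℤ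
    nonneg n = ifExp (psiExponent r s (+ n)) N (negOnePow (tri n))
    neg    j = ifExp (psiExponent r s -[1+ j ]) N (negOnePow (tri (suc j) ∸ suc j))

  -- quadratic b d x = (b + d) x² + b x, written on each sign of x so that it is visibly in ℕ.
  quadratic : ℕ → ℕ → ℤ → ℕ
  quadratic b d (+ n)    = (b ℕ.+ d) ℕ.* n ℕ.* n ℕ.+ b ℕ.* n
  quadratic b d -[1+ n ] = (b ℕ.+ d) ℕ.* n ℕ.* n ℕ.+ (b ℕ.+ 2 ℕ.* d) ℕ.* n ℕ.+ d

  quadratic-ℤ : ∀ b d x → + quadratic b d x ≡ + (b ℕ.+ d) * x * x + + b * x
  quadratic-ℤ b d (+ n) = begin
    + ((b ℕ.+ d) ℕ.* n ℕ.* n ℕ.+ b ℕ.* n)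
      ≡⟨ ℤₚ.pos-+ ((b ℕ.+ d) ℕ.* n ℕ.* n) (b ℕ.* n) ⟩
    + ((b ℕ.+ d) ℕ.* n ℕ.* n) + + (b ℕ.* n)
      ≡⟨ cong₂ _+_ (trans (ℤₚ.pos-* ((b ℕ.+ d) ℕ.* n) n) (cong (_* + n) (ℤₚ.pos-* (b ℕ.+ d) n))) (ℤₚ.pos-* b n) ⟩
    + (b ℕ.+ d) * + n * + n + + b * + n ∎
    where open ≡-Reasoning
  quadratic-ℤ b d -[1+ n ] = begin
    + ((b ℕ.+ d) ℕ.* n ℕ.* n ℕ.+ (b ℕ.+ 2 ℕ.* d) ℕ.* n ℕ.+ d)
      ≡⟨ ℤₚ.pos-+ ((b ℕ.+ d) ℕ.* n ℕ.* n ℕ.+ (b ℕ.+ 2 ℕ.* d) ℕ.* n) d ⟩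
    + ((b ℕ.+ d) ℕ.* n ℕ.* n ℕ.+ (b ℕ.+ 2 ℕ.* d) ℕ.* n) + + d
      ≡⟨ cong (_+ + d) (ℤₚ.pos-+ ((b ℕ.+ d) ℕ.* n ℕ.* n) ((b ℕ.+ 2 ℕ.* d) ℕ.* n)) ⟩
    + ((b ℕ.+ d) ℕ.* n ℕ.* n) + + ((b ℕ.+ 2 ℕ.* d) ℕ.* n) + + d
      ≡⟨ cong₂ (λ u v → u + v + + d)
           (trans (ℤₚ.pos-* ((b ℕ.+ d) ℕ.* n) n)
                  (cong (_* + n) (trans (ℤₚ.pos-* (b ℕ.+ d) n) (cong (_* + n) (ℤₚ.pos-+ b d)))))
           (trans (ℤₚ.pos-* (b ℕ.+ 2 ℕ.* d) n)
                  (cong (_* + n) (trans (ℤₚ.pos-+ b (2 ℕ.* d)) (cong (λ u → + b + u) (ℤₚ.pos-* 2 d))))) ⟩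
    (+ b + + d) * + n * + n + (+ b + + 2 * + d) * + n + + d
      ≡⟨ negative-branch (+ b) (+ d) (+ n) ⟩
    (+ b + + d) * -[1+ n ] * -[1+ n ] + + b * -[1+ n ]
      ≡⟨ cong (λ u → u * -[1+ n ] * -[1+ n ] + + b * -[1+ n ]) (sym (ℤₚ.pos-+ b d)) ⟩
    + (b ℕ.+ d) * -[1+ n ] * -[1+ n ] + + b * -[1+ n ] ∎
    where
    open ≡-Reasoning
    negative-branch : ∀ b d n → (b + d) * n * n + (b + + 2 * d) * n + d ≡
                                (b + d) * (- (+ 1 + n)) * (- (+ 1 + n)) + b * (- (+ 1 + n))
    negative-branch = solve-∀

  quadratic-coercive : ∀ b d → Coercive (quadratic b (suc d))
  quadratic-coercive b d (+ zero)   = ℕ.z≤n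
  quadratic-coercive b d (+ suc m)  = subst (suc m ≤_) (sym (nonneg b d m)) (ℕₚ.m≤m+n (suc m) _)
    where
    nonneg : ∀ b d m → (b ℕ.+ suc d) ℕ.* suc m ℕ.* suc m ℕ.+ b ℕ.* suc m ≡
                       suc m ℕ.+ (suc m ℕ.* ((b ℕ.+ d) ℕ.* suc m ℕ.+ m) ℕ.+ b ℕ.* suc m)
    nonneg = ℕ-Solver.solve-∀
  quadratic-coercive b d -[1+ n ] = subst (suc n ≤_) (sym (neg b d n)) (ℕₚ.m≤m+n (suc n) _)
    where
    neg : ∀ b d n → (b ℕ.+ suc d) ℕ.* n ℕ.* n ℕ.+ (b ℕ.+ 2 ℕ.* suc d) ℕ.* n ℕ.+ suc d ≡
                    suc n ℕ.+ ((b ℕ.+ suc d) ℕ.* n ℕ.* n ℕ.+ (b ℕ.+ 2 ℕ.* d ℕ.+ 1) ℕ.* n ℕ.+ d)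
    neg = ℕ-Solver.solve-∀

  Q₁ Q₂ Q₄ : ℤ → ℕ
  Q₁ = quadratic 1 4
  Q₂ = quadratic 2 3
  Q₄ = quadratic 4 1

  tri-double : ∀ m → 2 ℕ.* tri m ≡ m ℕ.* suc m
  tri-double zero    = refl
  tri-double (suc m) = begin
    2 ℕ.* (suc m ℕ.+ tri m)       ≡⟨ ℕₚ.*-distribˡ-+ 2 (suc m) (tri m) ⟩
    2 ℕ.* suc m ℕ.+ 2 ℕ.* tri m   ≡⟨ cong (2 ℕ.* suc m ℕ.+_) (tri-double m) ⟩
    2 ℕ.* suc m ℕ.+ m ℕ.* suc m   ≡⟨ ℕₚ.*-distribʳ-+ (suc m) 2 m ⟨
    suc (suc m) ℕ.* suc m         ≡⟨ ℕₚ.*-comm (suc (suc m)) (suc m) ⟩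
    suc m ℕ.* suc (suc m)         ∎
    where open ≡-Reasoning

  tri-suc∸suc : ∀ j → tri (suc j) ∸ suc j ≡ tri j
  tri-suc∸suc j = ℕₚ.m+n∸m≡n (suc j) (tri j)

  psiExponent-7-3 : ∀ x → psiExponent 7 3 x ≡ Q₂ x
  psiExponent-7-3 (+ zero)   = refl
  psiExponent-7-3 (+ suc m)  = begin
    7 ℕ.* (suc m ℕ.+ tri m) ℕ.+ 3 ℕ.* (tri (suc m) ∸ suc m)
      ≡⟨ cong (λ t → 7 ℕ.* (suc m ℕ.+ tri m) ℕ.+ 3 ℕ.* t) (tri-suc∸suc m) ⟩
    7 ℕ.* (suc m ℕ.+ tri m) ℕ.+ 3 ℕ.* tri m                 ≡⟨ collect m (tri m) ⟩
    7 ℕ.* suc m ℕ.+ 5 ℕ.* (2 ℕ.* tri m)                     ≡⟨ cong (λ t → 7 ℕ.* suc m ℕ.+ 5 ℕ.* t) (tri-double m) ⟩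
    7 ℕ.* suc m ℕ.+ 5 ℕ.* (m ℕ.* suc m)                     ≡⟨ expand m ⟩
    Q₂ (+ suc m)                                            ∎
    where
    open ≡-Reasoning
    collect : ∀ m t → 7 ℕ.* (suc m ℕ.+ t) ℕ.+ 3 ℕ.* t ≡ 7 ℕ.* suc m ℕ.+ 5 ℕ.* (2 ℕ.* t)
    collect = ℕ-Solver.solve-∀
    expand : ∀ m → 7 ℕ.* suc m ℕ.+ 5 ℕ.* (m ℕ.* suc m) ≡ 5 ℕ.* suc m ℕ.* suc m ℕ.+ 2 ℕ.* suc m
    expand = ℕ-Solver.solve-∀
  psiExponent-7-3 -[1+ j ] = begin
    7 ℕ.* (tri (suc j) ∸ suc j) ℕ.+ 3 ℕ.* (suc j ℕ.+ tri j)
      ≡⟨ cong (λ t → 7 ℕ.* t ℕ.+ 3 ℕ.* (suc j ℕ.+ tri j)) (tri-suc∸suc j) ⟩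
    7 ℕ.* tri j ℕ.+ 3 ℕ.* (suc j ℕ.+ tri j)                 ≡⟨ collect j (tri j) ⟩
    3 ℕ.* suc j ℕ.+ 5 ℕ.* (2 ℕ.* tri j)                     ≡⟨ cong (λ t → 3 ℕ.* suc j ℕ.+ 5 ℕ.* t) (tri-double j) ⟩
    3 ℕ.* suc j ℕ.+ 5 ℕ.* (j ℕ.* suc j)                     ≡⟨ expand j ⟩
    Q₂ -[1+ j ]                                             ∎
    where
    open ≡-Reasoning
    collect : ∀ j t → 7 ℕ.* t ℕ.+ 3 ℕ.* (suc j ℕ.+ t) ≡ 3 ℕ.* suc j ℕ.+ 5 ℕ.* (2 ℕ.* t)
    collect = ℕ-Solver.solve-∀
    expand : ∀ j → 3 ℕ.* suc j ℕ.+ 5 ℕ.* (j ℕ.* suc j) ≡ 5 ℕ.* j ℕ.* j ℕ.+ 8 ℕ.* j ℕ.+ 3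
    expand = ℕ-Solver.solve-∀

  parity-quadratic : ∀ b d x →
                     parity (quadratic b d x) ≡ (parity (b ℕ.+ d) ℙ.* (parityℤ x ℙ.* parityℤ x)) ⊕ (parity b ℙ.* parityℤ x)
  parity-quadratic b d x = begin
    parityℤ (+ quadratic b d x)
      ≡⟨ cong parityℤ (quadratic-ℤ b d x) ⟩
    parityℤ (+ (b ℕ.+ d) * x * x + + b * x)
      ≡⟨ parityℤ-+ (+ (b ℕ.+ d) * x * x) (+ b * x) ⟩
    parityℤ (+ (b ℕ.+ d) * x * x) ⊕ parityℤ (+ b * x)
      ≡⟨ cong₂ _⊕_ (trans (parityℤ-* (+ (b ℕ.+ d) * x) x) (trans (cong (ℙ._* parityℤ x) (parityℤ-* (+ (b ℕ.+ d)) x))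
                                                                  (ℙₚ.*-assoc (parity (b ℕ.+ d)) (parityℤ x) (parityℤ x))))
                   (parityℤ-* (+ b) x) ⟩
    (parity (b ℕ.+ d) ℙ.* (parityℤ x ℙ.* parityℤ x)) ⊕ (parity b ℙ.* parityℤ x) ∎
    where open ≡-Reasoning

  parity-Q₂ : ∀ x → parity (Q₂ x) ≡ parityℤ x
  parity-Q₂ x = trans (parity-quadratic 2 3 x) (trans (ℙₚ.+-identityʳ _) (ℙₚ.*-idem (parityℤ x)))

  parity-Q₄ : ∀ x → parity (Q₄ x) ≡ parityℤ x
  parity-Q₄ x = trans (parity-quadratic 4 1 x) (trans (ℙₚ.+-identityʳ _) (ℙₚ.*-idem (parityℤ x)))

  Q₁-coercive : Coercive Q₁
  Q₁-coercive = quadratic-coercive 1 3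

  Q₂-coercive : Coercive Q₂
  Q₂-coercive = quadratic-coercive 2 2

  Q₄-coercive : Coercive Q₄
  Q₄-coercive = quadratic-coercive 4 0

  pos-affine : ∀ c n d → + (c ℕ.* n ℕ.+ d) ≡ + c * + n + + d
  pos-affine c n d = trans (ℤₚ.pos-+ (c ℕ.* n) d) (cong (_+ + d) (ℤₚ.pos-* c n))

  σ : ℤ → ℤ
  σ x = - (+ 2 * x) - + 1

  Q₂-σ : ∀ x → Q₂ (σ x) ≡ 4 ℕ.* Q₄ x ℕ.+ 3
  Q₂-σ x = ℤₚ.+-injective (begin
    + Q₂ (σ x)                          ≡⟨ quadratic-ℤ 2 3 (σ x) ⟩
    + 5 * σ x * σ x + + 2 * σ x         ≡⟨ identity x ⟩
    + 4 * (+ 5 * x * x + + 4 * x) + + 3 ≡⟨ cong (λ u → + 4 * u + + 3) (quadratic-ℤ 4 1 x) ⟨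
    + 4 * + Q₄ x + + 3                  ≡⟨ pos-affine 4 (Q₄ x) 3 ⟨
    + (4 ℕ.* Q₄ x ℕ.+ 3)                ∎)
    where
    open ≡-Reasoning
    identity : ∀ x → + 5 * (- (+ 2 * x) - + 1) * (- (+ 2 * x) - + 1) + + 2 * (- (+ 2 * x) - + 1) ≡
                     + 4 * (+ 5 * x * x + + 4 * x) + + 3
    identity = solve-∀

  Q₂-2* : ∀ y → Q₂ (+ 2 * y) ≡ 4 ℕ.* Q₁ y
  Q₂-2* y = ℤₚ.+-injective (begin
    + Q₂ (+ 2 * y)                          ≡⟨ quadratic-ℤ 2 3 (+ 2 * y) ⟩
    + 5 * (+ 2 * y) * (+ 2 * y) + + 2 * (+ 2 * y) ≡⟨ identity y ⟩
    + 4 * (+ 5 * y * y + + 1 * y)           ≡⟨ cong (+ 4 *_) (quadratic-ℤ 1 4 y) ⟨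
    + 4 * + Q₁ y                            ≡⟨ ℤₚ.pos-* 4 (Q₁ y) ⟨
    + (4 ℕ.* Q₁ y)                          ∎)
    where
    open ≡-Reasoning
    identity : ∀ y → + 5 * (+ 2 * y) * (+ 2 * y) + + 2 * (+ 2 * y) ≡ + 4 * (+ 5 * y * y + + 1 * y)
    identity = solve-∀

  ρ : ℤ² → ℤ²
  ρ (x , y) = - x - y - + 1 , x - y

  Q₄-Q₂-ρ : ∀ x y → Q₄ (- x - y - + 1) ℕ.+ Q₂ (x - y) ≡ 2 ℕ.* (Q₄ x ℕ.+ Q₂ y) ℕ.+ 1
  Q₄-Q₂-ρ x y = ℤₚ.+-injective (begin
    + (Q₄ (- x - y - + 1) ℕ.+ Q₂ (x - y))
      ≡⟨ ℤₚ.pos-+ (Q₄ (- x - y - + 1)) (Q₂ (x - y)) ⟩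
    + Q₄ (- x - y - + 1) + + Q₂ (x - y)
      ≡⟨ cong₂ _+_ (quadratic-ℤ 4 1 (- x - y - + 1)) (quadratic-ℤ 2 3 (x - y)) ⟩
    (+ 5 * (- x - y - + 1) * (- x - y - + 1) + + 4 * (- x - y - + 1)) + (+ 5 * (x - y) * (x - y) + + 2 * (x - y))
      ≡⟨ identity x y ⟩
    + 2 * ((+ 5 * x * x + + 4 * x) + (+ 5 * y * y + + 2 * y)) + + 1
      ≡⟨ cong (λ u → + 2 * u + + 1) (cong₂ _+_ (quadratic-ℤ 4 1 x) (quadratic-ℤ 2 3 y)) ⟨
    + 2 * (+ Q₄ x + + Q₂ y) + + 1
      ≡⟨ cong (λ u → + 2 * u + + 1) (ℤₚ.pos-+ (Q₄ x) (Q₂ y)) ⟨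
    + 2 * + (Q₄ x ℕ.+ Q₂ y) + + 1
      ≡⟨ pos-affine 2 (Q₄ x ℕ.+ Q₂ y) 1 ⟨
    + (2 ℕ.* (Q₄ x ℕ.+ Q₂ y) ℕ.+ 1) ∎)
    where
    open ≡-Reasoning
    identity : ∀ x y → (+ 5 * (- x - y - + 1) * (- x - y - + 1) + + 4 * (- x - y - + 1)) + (+ 5 * (x - y) * (x - y) + + 2 * (x - y)) ≡
                       + 2 * ((+ 5 * x * x + + 4 * x) + (+ 5 * y * y + + 2 * y)) + + 1
    identity = solve-∀

  even⊎σ : ∀ a → (∃ λ r → a ≡ + 2 * r) ⊎ (∃ λ x → a ≡ σ x)
  even⊎σ a with a ℤ.%ℕ 2 | ℤDivMod.n%ℕd<d a 2 | ℤDivMod.a≡a%ℕn+[a/ℕn]*n a 2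
  ... | 0 | _ | a≡2q   = inj₁ (a ℤ./ℕ 2 , trans a≡2q (identity (a ℤ./ℕ 2)))
    where
    identity : ∀ q → + 0 + q * + 2 ≡ + 2 * q
    identity = solve-∀
  ... | 1 | _ | a≡1+2q = inj₂ (- (a ℤ./ℕ 2) - + 1 , trans a≡1+2q (identity (a ℤ./ℕ 2)))
    where
    identity : ∀ q → + 1 + q * + 2 ≡ - (+ 2 * (- q - + 1)) - + 1
    identity = solve-∀
  ... | suc (suc _) | ℕ.s≤s (ℕ.s≤s ()) | _

  parityℤ-2* : ∀ r → parityℤ (+ 2 * r) ≡ 0ℙ
  parityℤ-2* r = parityℤ-* (+ 2) r

  parityℤ-σ : ∀ x → parityℤ (σ x) ≡ 1ℙ
  parityℤ-σ x = begin
    parityℤ (- (+ 2 * x) + - + 1)           ≡⟨ parityℤ-+ (- (+ 2 * x)) (- + 1) ⟩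
    parityℤ (- (+ 2 * x)) ⊕ parityℤ (- + 1) ≡⟨ cong (_⊕ 1ℙ) (trans (parityℤ-neg (+ 2 * x)) (parityℤ-2* x)) ⟩
    1ℙ                                      ∎
    where open ≡-Reasoning

  parity-double : ∀ n → parity (double n) ≡ 0ℙ
  parity-double zero    = refl
  parity-double (suc n) = parity-double n

  parity-affine : ∀ c k d → parity (c ℕ.* k ℕ.+ d) ≡ (parity c ℙ.* parity k) ⊕ parity d
  parity-affine c k d = trans (ℙₚ.+-homo-+ (c ℕ.* k) d) (cong (_⊕ parity d) (ℙₚ.*-homo-* c k))

  parity-Q₂+double : ∀ a n → parity (Q₂ a ℕ.+ double n) ≡ parityℤ a
  parity-Q₂+double a n = trans (ℙₚ.+-homo-+ (Q₂ a) (double n))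
    (trans (cong₂ _⊕_ (parity-Q₂ a) (parity-double n)) (ℙₚ.+-identityʳ (parityℤ a)))

  affine-odd-odd : ∀ A B → (4 ℕ.* A ℕ.+ 3) ℕ.+ double (4 ℕ.* B ℕ.+ 3) ≡ 4 ℕ.* (2 ℕ.+ (A ℕ.+ double B)) ℕ.+ 1
  affine-odd-odd A B = begin
    (4 ℕ.* A ℕ.+ 3) ℕ.+ double (4 ℕ.* B ℕ.+ 3)   ≡⟨ cong ((4 ℕ.* A ℕ.+ 3) ℕ.+_) (double≡2* (4 ℕ.* B ℕ.+ 3)) ⟩
    (4 ℕ.* A ℕ.+ 3) ℕ.+ 2 ℕ.* (4 ℕ.* B ℕ.+ 3)    ≡⟨ identity A B ⟩
    4 ℕ.* (2 ℕ.+ (A ℕ.+ 2 ℕ.* B)) ℕ.+ 1         ≡⟨ cong (λ u → 4 ℕ.* (2 ℕ.+ (A ℕ.+ u)) ℕ.+ 1) (double≡2* B) ⟨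
    4 ℕ.* (2 ℕ.+ (A ℕ.+ double B)) ℕ.+ 1        ∎
    where
    open ≡-Reasoning
    identity : ∀ A B → (4 ℕ.* A ℕ.+ 3) ℕ.+ 2 ℕ.* (4 ℕ.* B ℕ.+ 3) ≡ 4 ℕ.* (2 ℕ.+ (A ℕ.+ 2 ℕ.* B)) ℕ.+ 1
    identity = ℕ-Solver.solve-∀

  affine-odd-even : ∀ A B → (4 ℕ.* A ℕ.+ 3) ℕ.+ double (4 ℕ.* B) ≡ 4 ℕ.* (A ℕ.+ double B) ℕ.+ 3
  affine-odd-even A B = begin
    (4 ℕ.* A ℕ.+ 3) ℕ.+ double (4 ℕ.* B)   ≡⟨ cong ((4 ℕ.* A ℕ.+ 3) ℕ.+_) (double≡2* (4 ℕ.* B)) ⟩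
    (4 ℕ.* A ℕ.+ 3) ℕ.+ 2 ℕ.* (4 ℕ.* B)    ≡⟨ identity A B ⟩
    4 ℕ.* (A ℕ.+ 2 ℕ.* B) ℕ.+ 3           ≡⟨ cong (λ u → 4 ℕ.* (A ℕ.+ u) ℕ.+ 3) (double≡2* B) ⟨
    4 ℕ.* (A ℕ.+ double B) ℕ.+ 3          ∎
    where
    open ≡-Reasoning
    identity : ∀ A B → (4 ℕ.* A ℕ.+ 3) ℕ.+ 2 ℕ.* (4 ℕ.* B) ≡ 4 ℕ.* (A ℕ.+ 2 ℕ.* B) ℕ.+ 3
    identity = ℕ-Solver.solve-∀

  4m+3≢4n+1 : ∀ m n → 4 ℕ.* m ℕ.+ 3 ≢ 4 ℕ.* n ℕ.+ 1
  4m+3≢4n+1 m n eq = ℕₚ.even≢odd n m (sym (ℕₚ.*-cancelˡ-≡ _ _ 2 (ℕₚ.suc-injective (begin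
    suc (2 ℕ.* suc (2 ℕ.* m))   ≡⟨ identity₁ m ⟩
    4 ℕ.* m ℕ.+ 3               ≡⟨ eq ⟩
    4 ℕ.* n ℕ.+ 1               ≡⟨ identity₂ n ⟩
    suc (2 ℕ.* (2 ℕ.* n))       ∎))))
    where
    open ≡-Reasoning
    identity₁ : ∀ m → suc (2 ℕ.* suc (2 ℕ.* m)) ≡ 4 ℕ.* m ℕ.+ 3
    identity₁ = ℕ-Solver.solve-∀
    identity₂ : ∀ n → 4 ℕ.* n ℕ.+ 1 ≡ suc (2 ℕ.* (2 ℕ.* n))
    identity₂ = ℕ-Solver.solve-∀

  ≢-by-parity : ∀ {m n} → parity m ≡ 0ℙ → parity n ≡ 1ℙ → m ≢ n
  ≢-by-parity m-even n-odd m≡n = 0ℙ≢1ℙ (trans (sym m-even) (trans (cong parity m≡n) n-odd))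

  σ-injective : ∀ {x x′} → σ x ≡ σ x′ → x ≡ x′
  σ-injective {x} {x′} σx≡σx′ = ℤₚ.*-cancelˡ-≡ (+ 2) x x′
    (trans (recover x) (trans (cong (λ u → - (u + + 1)) σx≡σx′) (sym (recover x′))))
    where
    recover : ∀ x → + 2 * x ≡ - ((- (+ 2 * x) - + 1) + + 1)
    recover = solve-∀

  ρ-injective : ∀ {z z′} → ρ z ≡ ρ z′ → z ≡ z′
  ρ-injective {x , y} {x′ , y′} ρz≡ρz′ =
    cong₂ _,_ x≡x′ (trans (recover-y x y) (trans (cong₂ _-_ sum≡ x≡x′) (sym (recover-y x′ y′))))
    where
    recover-sum : ∀ x y → x + y ≡ - ((- x - y - + 1) + + 1)
    recover-sum = solve-∀
    recover-2x : ∀ x y → + 2 * x ≡ (x + y) + (x - y)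
    recover-2x = solve-∀
    recover-y : ∀ x y → y ≡ (x + y) - x
    recover-y = solve-∀
    sum≡ : x + y ≡ x′ + y′
    sum≡ = trans (recover-sum x y) (trans (cong (λ u → - (u + + 1)) (,-injectiveˡ ρz≡ρz′)) (sym (recover-sum x′ y′)))
    x≡x′ : x ≡ x′
    x≡x′ = ℤₚ.*-cancelˡ-≡ (+ 2) x x′
      (trans (recover-2x x y) (trans (cong₂ _+_ sum≡ (,-injectiveʳ ρz≡ρz′)) (sym (recover-2x x′ y′))))

  -- Q₂ (σ x) = 4 Q₄ x + 3 and Q₂ (2 y) = 4 Q₁ y: in the fibre over 4k + 1 the parity of the exponent
  -- forces a to be odd, and then reduction modulo 4 forces b to be odd.
  θ²-Q₂-1mod4 : ∀ k → θ² (λ (a , b) → Q₂ a ℕ.+ double (Q₂ b)) (4 ℕ.* k ℕ.+ 1) ≡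
                      θ² (λ (x , y) → 2 ℕ.+ (Q₄ x ℕ.+ double (Q₄ y))) k
  θ²-Q₂-1mod4 k = θ²-affine 4 1 {k} (λ (x , y) → σ x , σ y)
    (Coercive²-+ Q₂-coercive (Coercive-double Q₂-coercive))
    (λ z → ℕₚ.≤-trans (Coercive²-+ Q₄-coercive (Coercive-double Q₄-coercive) z) (ℕₚ.m≤n+m _ 2))
    (λ (x , y) → trans (cong₂ (λ u v → u ℕ.+ double v) (Q₂-σ x) (Q₂-σ y)) (affine-odd-odd (Q₄ x) (Q₄ y)))
    onto
    (λ eq → cong₂ _,_ (σ-injective (,-injectiveˡ eq)) (σ-injective (,-injectiveʳ eq)))
    where
    open ≡-Reasoning
    onto : ∀ w → Q₂ (proj₁ w) ℕ.+ double (Q₂ (proj₂ w)) ≡ 4 ℕ.* k ℕ.+ 1 →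
           ∃ λ z → (σ (proj₁ z) , σ (proj₂ z)) ≡ w
    onto (a , b) E≡ with even⊎σ a | even⊎σ b
    ... | inj₁ (r , refl) | _ =
      ⊥-elim (≢-by-parity (trans (parity-Q₂+double (+ 2 * r) (Q₂ b)) (parityℤ-2* r)) (parity-affine 4 k 1) E≡)
    ... | inj₂ (x , refl) | inj₁ (r , refl) = ⊥-elim (4m+3≢4n+1 (Q₄ x ℕ.+ double (Q₁ r)) k (begin
      4 ℕ.* (Q₄ x ℕ.+ double (Q₁ r)) ℕ.+ 3         ≡⟨ affine-odd-even (Q₄ x) (Q₁ r) ⟨
      (4 ℕ.* Q₄ x ℕ.+ 3) ℕ.+ double (4 ℕ.* Q₁ r)   ≡⟨ cong₂ (λ u v → u ℕ.+ double v) (Q₂-σ x) (Q₂-2* r) ⟨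
      Q₂ (σ x) ℕ.+ double (Q₂ (+ 2 * r))           ≡⟨ E≡ ⟩
      4 ℕ.* k ℕ.+ 1                                ∎))
    ... | inj₂ (x , refl) | inj₂ (y , refl) = (x , y) , refl

  -- As above, but now b must be even.
  θ²-Q₂-3mod4 : ∀ k → θ² (λ (a , b) → Q₂ a ℕ.+ double (Q₂ b)) (4 ℕ.* k ℕ.+ 3) ≡
                      θ² (λ (x , y) → Q₄ x ℕ.+ double (Q₁ y)) k
  θ²-Q₂-3mod4 k = θ²-affine 4 3 {k} (λ (x , y) → σ x , + 2 * y)
    (Coercive²-+ Q₂-coercive (Coercive-double Q₂-coercive))
    (Coercive²-+ Q₄-coercive (Coercive-double Q₁-coercive))
    (λ (x , y) → trans (cong₂ (λ u v → u ℕ.+ double v) (Q₂-σ x) (Q₂-2* y)) (affine-odd-even (Q₄ x) (Q₁ y)))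
    onto
    (λ eq → cong₂ _,_ (σ-injective (,-injectiveˡ eq)) (ℤₚ.*-cancelˡ-≡ (+ 2) _ _ (,-injectiveʳ eq)))
    where
    open ≡-Reasoning
    onto : ∀ w → Q₂ (proj₁ w) ℕ.+ double (Q₂ (proj₂ w)) ≡ 4 ℕ.* k ℕ.+ 3 →
           ∃ λ z → (σ (proj₁ z) , + 2 * proj₂ z) ≡ w
    onto (a , b) E≡ with even⊎σ a | even⊎σ b
    ... | inj₁ (r , refl) | _ =
      ⊥-elim (≢-by-parity (trans (parity-Q₂+double (+ 2 * r) (Q₂ b)) (parityℤ-2* r)) (parity-affine 4 k 3) E≡)
    ... | inj₂ (x , refl) | inj₂ (y , refl) = ⊥-elim (4m+3≢4n+1 k (2 ℕ.+ (Q₄ x ℕ.+ double (Q₄ y))) (sym (begin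
      4 ℕ.* (2 ℕ.+ (Q₄ x ℕ.+ double (Q₄ y))) ℕ.+ 1   ≡⟨ affine-odd-odd (Q₄ x) (Q₄ y) ⟨
      (4 ℕ.* Q₄ x ℕ.+ 3) ℕ.+ double (4 ℕ.* Q₄ y ℕ.+ 3) ≡⟨ cong₂ (λ u v → u ℕ.+ double v) (Q₂-σ x) (Q₂-σ y) ⟨
      Q₂ (σ x) ℕ.+ double (Q₂ (σ y))                 ≡⟨ E≡ ⟩
      4 ℕ.* k ℕ.+ 3                                  ∎)))
    ... | inj₂ (x , refl) | inj₁ (r , refl) = (x , r) , refl

  -- An odd exponent forces a and b to have opposite parities, which is exactly when
  -- ρ (x , y) = (a , b) can be solved: x = (b - a - 1) / 2 and y = (-a - b - 1) / 2.
  θ²-Q₄Q₂-odd : ∀ n → θ² (λ (a , b) → Q₄ a ℕ.+ Q₂ b) (2 ℕ.* n ℕ.+ 1) ≡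
                      θ² (λ (a , b) → Q₄ a ℕ.+ Q₂ b) n
  θ²-Q₄Q₂-odd n = θ²-affine 2 1 {n} ρ coercive coercive (λ (x , y) → Q₄-Q₂-ρ x y) onto ρ-injective
    where
    coercive : Coercive² (λ (a , b) → Q₄ a ℕ.+ Q₂ b)
    coercive = Coercive²-+ Q₄-coercive Q₂-coercive
    parity-E : ∀ a b → parity (Q₄ a ℕ.+ Q₂ b) ≡ parityℤ a ⊕ parityℤ b
    parity-E a b = trans (ℙₚ.+-homo-+ (Q₄ a) (Q₂ b)) (cong₂ _⊕_ (parity-Q₄ a) (parity-Q₂ b))
    onto : ∀ w → Q₄ (proj₁ w) ℕ.+ Q₂ (proj₂ w) ≡ 2 ℕ.* n ℕ.+ 1 → ∃ λ z → ρ z ≡ w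
    onto (a , b) E≡ with even⊎σ a | even⊎σ b
    ... | inj₁ (q , refl) | inj₁ (s , refl) =
      ⊥-elim (≢-by-parity (trans (parity-E (+ 2 * q) (+ 2 * s)) (cong₂ _⊕_ (parityℤ-2* q) (parityℤ-2* s)))
                          (parity-affine 2 n 1) E≡)
    ... | inj₂ (t , refl) | inj₂ (u , refl) =
      ⊥-elim (≢-by-parity (trans (parity-E (σ t) (σ u)) (cong₂ _⊕_ (parityℤ-σ t) (parityℤ-σ u)))
                          (parity-affine 2 n 1) E≡)
    ... | inj₁ (q , refl) | inj₂ (u , refl) = (- u - q - + 1 , u - q) , cong₂ _,_ (identity₁ q u) (identity₂ q u)
      where
      identity₁ : ∀ q u → - (- u - q - + 1) - (u - q) - + 1 ≡ + 2 * q
      identity₁ = solve-∀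
      identity₂ : ∀ q u → (- u - q - + 1) - (u - q) ≡ - (+ 2 * u) - + 1
      identity₂ = solve-∀
    ... | inj₂ (t , refl) | inj₁ (r , refl) = (r + t , t - r) , cong₂ _,_ (identity₁ t r) (identity₂ t r)
      where
      identity₁ : ∀ t r → - (r + t) - (t - r) - + 1 ≡ - (+ 2 * t) - + 1
      identity₁ = solve-∀
      identity₂ : ∀ t r → (r + t) - (t - r) ≡ + 2 * r
      identity₂ = solve-∀

  Q₄-injective : ∀ {x y} → Q₄ x ≡ Q₄ y → x ≡ y
  Q₄-injective {x} {y} Q₄x≡Q₄y with ℤₚ.i*j≡0⇒i≡0∨j≡0 (x - y) {+ 5 * (x + y) + + 4} product≡0
    where
    factor : ∀ x y → (x - y) * (+ 5 * (x + y) + + 4) ≡ (+ 5 * x * x + + 4 * x) - (+ 5 * y * y + + 4 * y)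
    factor = solve-∀
    product≡0 : (x - y) * (+ 5 * (x + y) + + 4) ≡ + 0
    product≡0 = trans (factor x y) (trans (cong₂ _-_ (sym (quadratic-ℤ 4 1 x)) (sym (quadratic-ℤ 4 1 y)))
                      (trans (cong (λ u → u - + Q₄ y) (cong +_ Q₄x≡Q₄y)) (ℤₚ.+-inverseʳ (+ Q₄ y))))
  ... | inj₁ x-y≡0 = trans (split x y) (trans (cong (_+ y) x-y≡0) (ℤₚ.+-identityˡ y))
    where
    split : ∀ x y → x ≡ (x - y) + y
    split = solve-∀
  ... | inj₂ 5s+4≡0 = ⊥-elim (5m≢4 ∣ x + y ∣ (trans (sym (ℤₚ.abs-* (+ 5) (x + y))) (cong ∣_∣ 5s≡-4)))
    where
    5s≡-4 : + 5 * (x + y) ≡ - + 4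
    5s≡-4 = trans (shift (+ 5 * (x + y))) (cong (_- + 4) 5s+4≡0)
      where
      shift : ∀ u → u ≡ (u + + 4) - + 4
      shift = solve-∀
    5m≢4 : ∀ m → 5 ℕ.* m ≢ 4
    5m≢4 zero    ()
    5m≢4 (suc m) 5[1+m]≡4 with subst (5 ℕ.≤_) 5[1+m]≡4 (ℕₚ.m≤m*n 5 (suc m))
    ... | ℕ.s≤s (ℕ.s≤s (ℕ.s≤s (ℕ.s≤s ())))

  θ-Q₄≡1ℙ⇔ : ∀ n → θ Q₄ n ≡ 1ℙ ⇔ (∃ λ k → + n ≡ + 5 * k * k + + 4 * k)
  θ-Q₄≡1ℙ⇔ n = mk⇔ value-of-Q₄ θ-at-value
    where
    value-of-Q₄ : θ Q₄ n ≡ 1ℙ → ∃ λ k → + n ≡ + 5 * k * k + + 4 * k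
    value-of-Q₄ θ≡1 = let (x , _ , δ≡1) = ∑ℤ-witness n (λ x → 𝟙 (Q₄ x ≟ n)) θ≡1 in
      x , trans (cong +_ (sym (𝟙≡1ℙ⇒ (Q₄ x ≟ n) δ≡1))) (quadratic-ℤ 4 1 x)
    θ-at-value : (∃ λ k → + n ≡ + 5 * k * k + + 4 * k) → θ Q₄ n ≡ 1ℙ
    θ-at-value (k , n≡) = trans (∑ℤ-cong n (λ x → 𝟙-⇔ (Q₄ x ≟ n) (x ℤₚ.≟ k)
                                              (λ Q₄x≡n → Q₄-injective (trans Q₄x≡n (sym Q₄k≡n)))
                                              (λ { refl → Q₄k≡n })))
                                (∑ℤ-δ n k (subst (∣ k ∣ ≤_) Q₄k≡n (Q₄-coercive k)))
      where
      Q₄k≡n : Q₄ k ≡ n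
      Q₄k≡n = ℤₚ.+-injective (trans (quadratic-ℤ 4 1 k) (sym n≡))

  sum-of-squares : ∀ x y → 20 ℕ.* (Q₄ x ℕ.+ Q₁ y) ℕ.+ 17 ≡
                           ∣ + 10 * x + + 4 ∣ ℕ.* ∣ + 10 * x + + 4 ∣ ℕ.+ ∣ + 10 * y + + 1 ∣ ℕ.* ∣ + 10 * y + + 1 ∣
  sum-of-squares x y = ℤₚ.+-injective (begin
    + (20 ℕ.* (Q₄ x ℕ.+ Q₁ y) ℕ.+ 17)
      ≡⟨ pos-affine 20 (Q₄ x ℕ.+ Q₁ y) 17 ⟩
    + 20 * + (Q₄ x ℕ.+ Q₁ y) + + 17
      ≡⟨ cong (λ u → + 20 * u + + 17)
              (trans (ℤₚ.pos-+ (Q₄ x) (Q₁ y)) (cong₂ _+_ (quadratic-ℤ 4 1 x) (quadratic-ℤ 1 4 y))) ⟩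
    + 20 * ((+ 5 * x * x + + 4 * x) + (+ 5 * y * y + + 1 * y)) + + 17
      ≡⟨ identity x y ⟩
    (+ 10 * x + + 4) * (+ 10 * x + + 4) + (+ 10 * y + + 1) * (+ 10 * y + + 1)
      ≡⟨ cong₂ _+_ (square-abs (+ 10 * x + + 4)) (square-abs (+ 10 * y + + 1)) ⟩
    + (∣ + 10 * x + + 4 ∣ ℕ.* ∣ + 10 * x + + 4 ∣) + + (∣ + 10 * y + + 1 ∣ ℕ.* ∣ + 10 * y + + 1 ∣)
      ≡⟨ ℤₚ.pos-+ (∣ + 10 * x + + 4 ∣ ℕ.* ∣ + 10 * x + + 4 ∣) _ ⟨
    + (∣ + 10 * x + + 4 ∣ ℕ.* ∣ + 10 * x + + 4 ∣ ℕ.+ ∣ + 10 * y + + 1 ∣ ℕ.* ∣ + 10 * y + + 1 ∣) ∎)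
    where
    open ≡-Reasoning
    identity : ∀ x y → + 20 * ((+ 5 * x * x + + 4 * x) + (+ 5 * y * y + + 1 * y)) + + 17 ≡
                       (+ 10 * x + + 4) * (+ 10 * x + + 4) + (+ 10 * y + + 1) * (+ 10 * y + + 1)
    identity = solve-∀
    square-abs : ∀ a → a * a ≡ + (∣ a ∣ ℕ.* ∣ a ∣)
    square-abs (+ n)    = sym (ℤₚ.pos-* n n)
    square-abs -[1+ n ] = refl

module SumsOfTwoSquares where
  open import Data.Nat.Base
  open import Data.Nat.Properties
  open import Data.Nat.Divisibility
  open import Data.Nat.Primality using (Prime; euclidsLemma; prime⇒nonTrivial; prime⇒nonZero)
  open import Data.Nat.Combinatorics using (_C_; nCk≡n!/k![n-k]!; k![n∸k]!∣n!; nCn≡1)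
  open import Data.Nat.DivMod using (m*[n/m]≡n; _/_; _%_; m≡m%n+[m/n]*n; m%n≤m)
  import Data.Nat.Tactic.RingSolver as ℕ-Solver
  open import Data.Fin.Base using (Fin; zero; suc; toℕ; fromℕ)
  open import Data.Fin.Properties using (toℕ-inject₁; toℕ-fromℕ; toℕ<n)
  open import Data.Vec.Functional using (Vector; init)
  open import Data.Product.Base using (∃; _,_)
  open import Data.Sum.Base using (inj₁; inj₂; [_,_]′)
  open import Function.Base using (_∘_)
  open import Relation.Binary.PropositionalEquality
  open import Relation.Nullary.Negation.Core using (¬_; contradiction)
  open import Relation.Nullary.Decidable.Core using (yes; no)
  import Algebra.Properties.CommutativeSemiring.Binomial +-*-commutativeSemiring as Binomial
  open import Algebra.Properties.Monoid.Sum +-0-monoid using (sum; sum-init-last; sum-cong-≗)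
  import Algebra.Properties.Semiring.Exp +-*-semiring as Semiring
  import Algebra.Definitions.RawMonoid +-0-rawMonoid as Monoid

  prime∤! : ∀ {p m} → Prime p → m < p → ¬ p ∣ m !
  prime∤! {p} {zero}  p-prime _     p∣1 = nonTrivial⇒≢1 {{prime⇒nonTrivial p-prime}} (∣1⇒≡1 p∣1)
  prime∤! {p} {suc m} p-prime m<p p∣m! with euclidsLemma (suc m) (m !) p-prime p∣m!
  ... | inj₁ p∣1+m = <⇒≱ m<p (∣⇒≤ p∣1+m)
  ... | inj₂ p∣m!  = prime∤! p-prime (<-trans (n<1+n m) m<p) p∣m!

  k![n∸k]!*nCk≡n! : ∀ {n k} → k ≤ n → (k ! * (n ∸ k) !) * (n C k) ≡ n !
  k![n∸k]!*nCk≡n! {n} {k} k≤n = trans (cong ((k ! * (n ∸ k) !) *_) (nCk≡n!/k![n-k]! k≤n)) (m*[n/m]≡n (k![n∸k]!∣n! k≤n))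
    where instance _ = k !* (n ∸ k) !≢0

  prime∣C : ∀ {p j} → Prime p → 0 < j → j < p → p ∣ p C j
  prime∣C {suc n} {suc j} p-prime _ j<p
    with euclidsLemma (suc j ! * (n ∸ j) !) (suc n C suc j) p-prime
           (subst (suc n ∣_) (sym (k![n∸k]!*nCk≡n! (<⇒≤ j<p))) (m∣m*n (n !)))
  ... | inj₂ p∣C = p∣C
  ... | inj₁ p∣j!*[n∸j]! = contradiction (euclidsLemma (suc j !) ((n ∸ j) !) p-prime p∣j!*[n∸j]!)
                             [ prime∤! p-prime j<p , prime∤! p-prime (s≤s (m∸n≤m n j)) ]′

  ^-semiring≡^ : ∀ x n → x Semiring.^ n ≡ x ^ n
  ^-semiring≡^ x zero    = refl
  ^-semiring≡^ x (suc n) = cong (x *_) (^-semiring≡^ x n)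

  ×≡* : ∀ n x → n Monoid.× x ≡ n * x
  ×≡* zero    x = refl
  ×≡* (suc n) x = cong (x +_) (×≡* n x)

  binomial : ∀ n a → (1 + a) ^ n ≡ sum (λ (k : Fin (suc n)) → (n C toℕ k) * a ^ (n ∸ toℕ k))
  binomial n a = begin
    (1 + a) ^ n                 ≡⟨ ^-semiring≡^ (1 + a) n ⟨
    (1 + a) Semiring.^ n        ≡⟨ Binomial.theorem n 1 a ⟩
    Binomial.binomialExpansion 1 a n ≡⟨ sum-cong-≗ {suc n} term ⟩
    sum {suc n} (λ k → (n C toℕ k) * a ^ (n ∸ toℕ k)) ∎
    where
    open ≡-Reasoning
    term : ∀ k → (n C toℕ k) Monoid.× (1 Semiring.^ toℕ k * a Semiring.^ (n ∸ toℕ k)) ≡ (n C toℕ k) * a ^ (n ∸ toℕ k)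
    term k = trans (×≡* (n C toℕ k) _) (cong ((n C toℕ k) *_)
      (trans (cong₂ _*_ (trans (^-semiring≡^ 1 (toℕ k)) (^-zeroˡ (toℕ k))) (^-semiring≡^ a (n ∸ toℕ k))) (*-identityˡ _)))

  ∣-sum : ∀ {d} n (f : Vector ℕ n) → (∀ i → d ∣ f i) → d ∣ sum f
  ∣-sum {d} zero f d∣f = d ∣0
  ∣-sum {d} (suc n) f d∣f = ∣m∣n⇒∣m+n (d∣f zero) (∣-sum n (f ∘ suc) (d∣f ∘ suc))

  -- The binomial coefficients strictly between the ends are divisible by p.
  freshman : ∀ {p} → Prime p → ∀ a → ∃ λ s → (1 + a) ^ p ≡ a ^ p + p * s + 1
  freshman {suc n} p-prime a = quotient p∣middle , (begin
    (1 + a) ^ suc n                                          ≡⟨ binomial (suc n) a ⟩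
    term zero + sum (term ∘ suc)                             ≡⟨ cong (term zero +_) (sum-init-last (term ∘ suc)) ⟩
    term zero + (sum (init (term ∘ suc)) + term (suc (fromℕ n)))
      ≡⟨ cong₂ (λ u v → u + (sum (init (term ∘ suc)) + v)) (*-identityˡ (a ^ suc n)) last≡1 ⟩
    a ^ suc n + (sum (init (term ∘ suc)) + 1)                ≡⟨ +-assoc (a ^ suc n) _ 1 ⟨
    a ^ suc n + sum (init (term ∘ suc)) + 1                  ≡⟨ cong (λ m → a ^ suc n + m + 1) (m∣n⇒n≡m*quotient p∣middle) ⟩
    a ^ suc n + suc n * quotient p∣middle + 1                ∎)
    where
    open ≡-Reasoning
    term : Fin (suc (suc n)) → ℕ
    term k = (suc n C toℕ k) * a ^ (suc n ∸ toℕ k)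
    p∣middle : suc n ∣ sum (init (term ∘ suc))
    p∣middle = ∣-sum n (init (term ∘ suc)) (λ k → ∣m⇒∣m*n _
      (prime∣C p-prime (s≤s z≤n) (s≤s (subst (_< n) (sym (toℕ-inject₁ k)) (toℕ<n k)))))
    last≡1 : term (suc (fromℕ n)) ≡ 1
    last≡1 = begin
      (suc n C suc (toℕ (fromℕ n))) * a ^ (n ∸ toℕ (fromℕ n)) ≡⟨ cong (λ m → (suc n C suc m) * a ^ (n ∸ m)) (toℕ-fromℕ n) ⟩
      (suc n C suc n) * a ^ (n ∸ n)                           ≡⟨ cong₂ (λ u v → u * a ^ v) (nCn≡1 (suc n)) (n∸n≡0 n) ⟩
      1                                                       ∎

  fermat : ∀ {p} → Prime p → ∀ a → ∃ λ m → a ^ p ≡ a + p * m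
  fermat {suc n} p-prime zero    = 0 , sym (*-zeroʳ (suc n))
  fermat {suc n} p-prime (suc a) =
    let (s , 1+a^p≡) = freshman p-prime a
        (m , a^p≡)   = fermat p-prime a
    in s + m , (begin
      (1 + a) ^ suc n                       ≡⟨ 1+a^p≡ ⟩
      a ^ suc n + suc n * s + 1             ≡⟨ cong (λ u → u + suc n * s + 1) a^p≡ ⟩
      a + suc n * m + suc n * s + 1         ≡⟨ rearrange a (suc n) m s ⟩
      suc a + suc n * (s + m)               ∎)
    where
    open ≡-Reasoning
    rearrange : ∀ a p m s → a + p * m + p * s + 1 ≡ suc a + p * (s + m)
    rearrange = ℕ-Solver.solve-∀

  fermat-coprime : ∀ {n} → Prime (suc n) → ∀ a → ¬ suc n ∣ a → ∃ λ m → a ^ n ≡ 1 + suc n * m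
  fermat-coprime {n} p-prime a p∤a with fermat p-prime a
  ... | m , a^p≡ with a ^ n
  ...   | zero  = contradiction (subst (suc n ∣_) (sym a≡0) (suc n ∣0)) p∤a
    where
    a≡0 : a ≡ 0
    a≡0 = m+n≡0⇒m≡0 a (sym (trans (sym (*-zeroʳ a)) a^p≡))
  ...   | suc t with euclidsLemma a t p-prime (divides m a*t≡m*p)
    where
    a*t≡m*p : a * t ≡ m * suc n
    a*t≡m*p = +-cancelˡ-≡ a (a * t) (m * suc n)
      (trans (sym (*-suc a t)) (trans a^p≡ (cong (a +_) (*-comm (suc n) m))))
  ...     | inj₁ p∣a = contradiction p∣a p∤a
  ...     | inj₂ (divides q t≡q*p) = q , cong suc (trans t≡q*p (*-comm q (suc n)))

  ∣x+y⇒∣x^odd+y^odd : ∀ {d} x y s → d ∣ x + y → d ∣ x ^ (1 + 2 * s) + y ^ (1 + 2 * s)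
  ∣x+y⇒∣x^odd+y^odd {d} x y zero    d∣x+y = subst (d ∣_) (sym (cong₂ _+_ (*-identityʳ x) (*-identityʳ y))) d∣x+y
  ∣x+y⇒∣x^odd+y^odd {d} x y (suc s) d∣x+y = subst (λ e → d ∣ x ^ e + y ^ e) (sym (exponent s))
    (∣m+n∣m⇒∣n (subst (d ∣_) (expand x y (x ^ (1 + 2 * s)) (y ^ (1 + 2 * s))) (∣m⇒∣m*n _ d∣x+y))
               (∣n⇒∣m*n (x * y) (∣x+y⇒∣x^odd+y^odd x y s d∣x+y)))
    where
    exponent : ∀ s → 1 + 2 * suc s ≡ 2 + (1 + 2 * s)
    exponent = ℕ-Solver.solve-∀
    expand : ∀ x y X Y → (x + y) * (x * X + y * Y) ≡ x * y * (X + Y) + (x * (x * X) + y * (y * Y))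
    expand = ℕ-Solver.solve-∀

  -- For p = 4t + 3, Fermat gives (a²)^(2t+1) + (b²)^(2t+1) ≡ 2 (mod p) when p ∤ a, while an odd
  -- power sum is divisible by p whenever a² + b² is; so p ∣ 2, which is absurd.
  prime≡3mod4-∣-sum-of-squares : ∀ {p} → Prime p → p % 4 ≡ 3 → ∀ a b → p ∣ a * a + b * b → p ∣ a
  prime≡3mod4-∣-sum-of-squares {p} p-prime p%4≡3 a b p∣a²+b² with p ∣? a
  ... | yes p∣a = p∣a
  ... | no  p∤a = contradiction (∣⇒≤ p∣2) (<⇒≱ 2<p)
    where
    t : ℕ
    t = p / 4
    p≡ : p ≡ suc (2 * suc (2 * t))
    p≡ = trans (m≡m%n+[m/n]*n p 4) (trans (cong (_+ t * 4) p%4≡3) (shape t))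
      where
      shape : ∀ t → 3 + t * 4 ≡ suc (2 * suc (2 * t))
      shape = ℕ-Solver.solve-∀
    2<p : 2 < p
    2<p = subst (_≤ p) p%4≡3 (m%n≤m p 4)
    p∤b : ¬ p ∣ b
    p∤b p∣b = [ p∤a , p∤a ]′ (euclidsLemma a a p-prime
      (∣m+n∣m⇒∣n (subst (p ∣_) (+-comm (a * a) (b * b)) p∣a²+b²) (∣m⇒∣m*n b p∣b)))
    square-power : ∀ x → ¬ p ∣ x → ∃ λ m → (x * x) ^ suc (2 * t) ≡ 1 + p * m
    square-power x p∤x = let (m , x^[p-1]≡) = fermat-coprime (subst Prime p≡ p-prime) x (p∤x ∘ subst (_∣ x) (sym p≡)) in
      m , (begin
        (x * x) ^ suc (2 * t)          ≡⟨ cong (λ y → (x * y) ^ suc (2 * t)) (*-identityʳ x) ⟨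
        (x ^ 2) ^ suc (2 * t)          ≡⟨ ^-*-assoc x 2 (suc (2 * t)) ⟩
        x ^ (2 * suc (2 * t))          ≡⟨ x^[p-1]≡ ⟩
        1 + suc (2 * suc (2 * t)) * m  ≡⟨ cong (λ q → 1 + q * m) p≡ ⟨
        1 + p * m                      ∎)
      where open ≡-Reasoning
    p∣2 : p ∣ 2
    p∣2 = let (m₁ , a²≡) = square-power a p∤a
              (m₂ , b²≡) = square-power b p∤b in
      ∣m+n∣m⇒∣n (subst (p ∣_) (trans (cong₂ _+_ a²≡ b²≡) (rearrange p m₁ m₂))
                           (∣x+y⇒∣x^odd+y^odd (a * a) (b * b) t p∣a²+b²))
                (∣m⇒∣m*n (m₁ + m₂) ∣-refl)
      where
      rearrange : ∀ p m₁ m₂ → 1 + p * m₁ + (1 + p * m₂) ≡ p * (m₁ + m₂) + 2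
      rearrange = ℕ-Solver.solve-∀

  p²∣sum-of-squares : ∀ {p} → Prime p → p % 4 ≡ 3 → ∀ {a b n} → a * a + b * b ≡ p * n →
                      ∃ λ a′ → ∃ λ b′ → p * (p * (a′ * a′ + b′ * b′)) ≡ p * n
  p²∣sum-of-squares {p} p-prime p%4≡3 {a} {b} {n} a²+b²≡ with p∣a | p∣b
    where
    p∣a²+b² : p ∣ a * a + b * b
    p∣a²+b² = subst (p ∣_) (sym a²+b²≡) (m∣m*n n)
    p∣a = prime≡3mod4-∣-sum-of-squares p-prime p%4≡3 a b p∣a²+b²
    p∣b = prime≡3mod4-∣-sum-of-squares p-prime p%4≡3 b a (subst (p ∣_) (+-comm (a * a) (b * b)) p∣a²+b²)
  ... | divides a′ refl | divides b′ refl = a′ , b′ , trans (rearrange a′ b′ p) a²+b²≡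
    where
    rearrange : ∀ a′ b′ p → p * (p * (a′ * a′ + b′ * b′)) ≡ a′ * p * (a′ * p) + b′ * p * (b′ * p)
    rearrange = ℕ-Solver.solve-∀

  sum-of-squares≢ : ∀ {p} → Prime p → p % 4 ≡ 3 → ∀ j a b w → ¬ p ∣ w → a * a + b * b ≢ p ^ (2 * j + 1) * w
  sum-of-squares≢ {p} p-prime p%4≡3 zero a b w p∤w a²+b²≡ =
    let (a′ , b′ , reduced) = p²∣sum-of-squares p-prime p%4≡3 {a} {b} (trans a²+b²≡ (*-assoc p 1 w)) in
    p∤w (divides (a′ * a′ + b′ * b′) (trans (sym (*-cancelˡ-≡ _ _ p (trans reduced (cong (p *_) (*-identityˡ w)))))
                                            (*-comm p _)))
    where instance _ = prime⇒nonZero p-prime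
  sum-of-squares≢ {p} p-prime p%4≡3 (suc j) a b w p∤w a²+b²≡ =
    let (a′ , b′ , reduced) = p²∣sum-of-squares p-prime p%4≡3 {a} {b} (trans a²+b²≡ p^[2j+3]w≡) in
    sum-of-squares≢ p-prime p%4≡3 j a′ b′ w p∤w (*-cancelˡ-≡ _ _ p (*-cancelˡ-≡ _ _ p reduced))
    where
    instance _ = prime⇒nonZero p-prime
    p^[2j+3]w≡ : p ^ (2 * suc j + 1) * w ≡ p * (p * (p ^ (2 * j + 1) * w))
    p^[2j+3]w≡ = trans (cong (λ e → p ^ e * w) (exponent j)) (trans (*-assoc p _ w) (cong (p *_) (*-assoc p _ w)))
      where
      exponent : ∀ j → 2 * suc j + 1 ≡ 2 + (2 * j + 1)
      exponent = ℕ-Solver.solve-∀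

module Dissection (c : ℕ → ℤ) (isC : IsC 7 3 c) where
  open import Data.Nat.Base using (zero; suc; _+_; _*_)
  open PowerSeries
  open Reduction
  open ThetaSeries
  open Exponents
  import Data.Nat.Properties as ℕₚ
  open import Data.Nat.Properties using (_≟_)
  import Data.Nat.Tactic.RingSolver as ℕ-Solver
  open import Data.Parity.Base using (0ℙ)
  open import Data.Fin.Patterns using (0F; 1F; 2F; 3F; 4F; 5F)
  open import Data.Vec.Base using ([]; _∷_)
  open import Data.Product.Base using (_,_)
  open import Relation.Binary.PropositionalEquality
  open import Function.Base using (_∘_)
  import Relation.Binary.Reasoning.Setoid as SetoidReasoning
  module ≈-Reasoning = SetoidReasoning ≈-setoid
  open ⊛-Solver using (prove; var) renaming (_⊕_ to _⊹_)

  C F G E P : Series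
  C = reduce c
  F = θ Q₂
  G = θ Q₄
  E = θ Q₁
  P = G ⊛ F

  F⊛C≈1 : F ⊛ C ≈ 1ₛ
  F⊛C≈1 = ≈-trans (⊛-cong F≈ψ ≈-refl) (IsC⇒reduce-inverse {7} {3} {c} isC)
    where
    F≈ψ : F ≈ reduce (psiCoeff 7 3)
    F≈ψ N = sym (trans (reduce-psiCoeff 7 3 N) (∑ℤ-cong N (λ x → cong (λ e → 𝟙 (e ≟ N)) (psiExponent-7-3 x))))

  C≈F⊛F²⊛C⁴ : C ≈ (F ⊛ dilate F) ⊛ dilate (dilate C)
  C≈F⊛F²⊛C⁴ = begin
    C                                     ≈⟨ C≈F⊛C² ⟩
    F ⊛ dilate C                          ≈⟨ ⊛-cong ≈-refl (dilate-cong C≈F⊛C²) ⟩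
    F ⊛ dilate (F ⊛ dilate C)             ≈⟨ ⊛-cong ≈-refl (dilate-⊛ F (dilate C)) ⟩
    F ⊛ (dilate F ⊛ dilate (dilate C))    ≈⟨ ⊛-assoc F (dilate F) (dilate (dilate C)) ⟨
    (F ⊛ dilate F) ⊛ dilate (dilate C)    ∎
    where
    open ≈-Reasoning
    C≈F⊛C² : C ≈ F ⊛ dilate C
    C≈F⊛C² = inverse-dilate F C F⊛C≈1

  F⊛F²≈θ² : F ⊛ dilate F ≈ θ² (λ (a , b) → Q₂ a + double (Q₂ b))
  F⊛F²≈θ² = ≈-trans (⊛-cong ≈-refl (dilate-θ Q₂-coercive)) (θ-⊛ Q₂-coercive (Coercive-double Q₂-coercive))

  index-4k+1 : ∀ k → suc (double (double k)) ≡ 4 * k + 1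
  index-4k+1 k = trans (cong suc (double-double≡4* k)) (ℕₚ.+-comm 1 (4 * k))

  index-4k+3 : ∀ k → suc (double (suc (double k))) ≡ 4 * k + 3
  index-4k+3 k = trans (cong (3 +_) (double-double≡4* k)) (ℕₚ.+-comm 3 (4 * k))

  index-2k+1 : ∀ k → suc (double k) ≡ 2 * k + 1
  index-2k+1 k = trans (cong suc (double≡2* k)) (ℕₚ.+-comm 1 (2 * k))

  F⊛F²-1mod4 : evenPart (oddPart (F ⊛ dilate F)) ≈ q^ 2 ⊛ (G ⊛ dilate G)
  F⊛F²-1mod4 k = begin
    (F ⊛ dilate F) (suc (double (double k)))                   ≡⟨ F⊛F²≈θ² (suc (double (double k))) ⟩
    θ² (λ (a , b) → Q₂ a + double (Q₂ b)) (suc (double (double k)))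
                                                               ≡⟨ cong (θ² (λ (a , b) → Q₂ a + double (Q₂ b))) (index-4k+1 k) ⟩
    θ² (λ (a , b) → Q₂ a + double (Q₂ b)) (4 * k + 1)    ≡⟨ θ²-Q₂-1mod4 k ⟩
    θ² (λ (x , y) → 2 + (Q₄ x + double (Q₄ y))) k          ≡⟨ q^-⊛-θ² 2 (Coercive²-+ Q₄-coercive (Coercive-double Q₄-coercive)) k ⟨
    (q^ 2 ⊛ θ² (λ (x , y) → Q₄ x + double (Q₄ y))) k          ≡⟨ ⊛-cong ≈-refl (≈-sym G⊛G²≈θ²) k ⟩
    (q^ 2 ⊛ (G ⊛ dilate G)) k                                   ∎
    where
    open ≡-Reasoning
    G⊛G²≈θ² : G ⊛ dilate G ≈ θ² (λ (x , y) → Q₄ x + double (Q₄ y))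
    G⊛G²≈θ² = ≈-trans (⊛-cong ≈-refl (dilate-θ Q₄-coercive)) (θ-⊛ Q₄-coercive (Coercive-double Q₄-coercive))

  F⊛F²-3mod4 : oddPart (oddPart (F ⊛ dilate F)) ≈ G ⊛ dilate E
  F⊛F²-3mod4 k = begin
    (F ⊛ dilate F) (suc (double (suc (double k))))             ≡⟨ F⊛F²≈θ² (suc (double (suc (double k)))) ⟩
    θ² (λ (a , b) → Q₂ a + double (Q₂ b)) (suc (double (suc (double k))))
                                                               ≡⟨ cong (θ² (λ (a , b) → Q₂ a + double (Q₂ b))) (index-4k+3 k) ⟩
    θ² (λ (a , b) → Q₂ a + double (Q₂ b)) (4 * k + 3)    ≡⟨ θ²-Q₂-3mod4 k ⟩
    θ² (λ (x , y) → Q₄ x + double (Q₁ y)) k                  ≡⟨ θ-⊛ Q₄-coercive (Coercive-double Q₁-coercive) k ⟨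
    (G ⊛ θ (double ∘ Q₁)) k                                    ≡⟨ ⊛-cong ≈-refl (≈-sym (dilate-θ Q₁-coercive)) k ⟩
    (G ⊛ dilate E) k                                           ∎
    where open ≡-Reasoning

  P≈θ² : P ≈ θ² (λ (a , b) → Q₄ a + Q₂ b)
  P≈θ² = θ-⊛ Q₄-coercive Q₂-coercive

  oddPart-P : oddPart P ≈ P
  oddPart-P n = begin
    P (suc (double n))                             ≡⟨ P≈θ² (suc (double n)) ⟩
    θ² (λ (a , b) → Q₄ a + Q₂ b) (suc (double n)) ≡⟨ cong (θ² (λ (a , b) → Q₄ a + Q₂ b)) (index-2k+1 n) ⟩
    θ² (λ (a , b) → Q₄ a + Q₂ b) (2 * n + 1)  ≡⟨ θ²-Q₄Q₂-odd n ⟩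
    θ² (λ (a , b) → Q₄ a + Q₂ b) n                ≡⟨ P≈θ² n ⟨
    P n                                            ∎
    where open ≡-Reasoning

  P⊛C≈G : P ⊛ C ≈ G
  P⊛C≈G = ≈-trans (⊛-assoc G F C) (≈-trans (⊛-cong ≈-refl F⊛C≈1) (⊛-identityʳ G))

  Y : Series
  Y = P ⊛ dilate (P ⊛ dilate C)

  C-1mod4 : evenPart (oddPart C) ≈ q^ 2 ⊛ Y
  C-1mod4 = begin
    evenPart (oddPart C)
      ≈⟨ (λ k → C≈F⊛F²⊛C⁴ (suc (double (double k)))) ⟩
    evenPart (oddPart ((F ⊛ dilate F) ⊛ dilate (dilate C)))
      ≈⟨ evenPart-oddPart-⊛-dilate² (F ⊛ dilate F) C ⟩
    evenPart (oddPart (F ⊛ dilate F)) ⊛ C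
      ≈⟨ ⊛-cong F⊛F²-1mod4 C≈F⊛F²⊛C⁴ ⟩
    (q^ 2 ⊛ (G ⊛ dilate G)) ⊛ ((F ⊛ dilate F) ⊛ dilate (dilate C))
      ≈⟨ prove 6 ((q² ⊹ (g ⊹ g²)) ⊹ ((f ⊹ f²) ⊹ c⁴)) (q² ⊹ ((g ⊹ f) ⊹ ((g² ⊹ f²) ⊹ c⁴)))
                 (q^ 2 ∷ G ∷ dilate G ∷ F ∷ dilate F ∷ dilate (dilate C) ∷ []) ⟩
    q^ 2 ⊛ (P ⊛ ((dilate G ⊛ dilate F) ⊛ dilate (dilate C)))
      ≈⟨ ⊛-cong ≈-refl (⊛-cong ≈-refl (≈-trans (⊛-cong (≈-sym (dilate-⊛ G F)) ≈-refl) (≈-sym (dilate-⊛ P (dilate C))))) ⟩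
    q^ 2 ⊛ Y ∎
    where
    open ≈-Reasoning
    q² = var 0F
    g  = var 1F
    g² = var 2F
    f  = var 3F
    f² = var 4F
    c⁴ = var 5F

  oddPart-Y : oddPart Y ≈ dilate G
  oddPart-Y = begin
    oddPart (P ⊛ dilate (P ⊛ dilate C)) ≈⟨ oddPart-⊛-dilate P (P ⊛ dilate C) ⟩
    oddPart P ⊛ (P ⊛ dilate C)          ≈⟨ ⊛-cong oddPart-P ≈-refl ⟩
    P ⊛ (P ⊛ dilate C)                  ≈⟨ ⊛-assoc P P (dilate C) ⟨
    (P ⊛ P) ⊛ dilate C                  ≈⟨ ⊛-cong (frobenius P) ≈-refl ⟩
    dilate P ⊛ dilate C                 ≈⟨ dilate-⊛ P C ⟨
    dilate (P ⊛ C)                      ≈⟨ dilate-cong P⊛C≈G ⟩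
    dilate G                            ∎
    where open ≈-Reasoning

  C-3mod4 : oddPart (oddPart C) ≈ P ⊛ dilate (E ⊛ C)
  C-3mod4 = begin
    oddPart (oddPart C)
      ≈⟨ (λ k → C≈F⊛F²⊛C⁴ (suc (double (suc (double k))))) ⟩
    oddPart (oddPart ((F ⊛ dilate F) ⊛ dilate (dilate C)))
      ≈⟨ oddPart-oddPart-⊛-dilate² (F ⊛ dilate F) C ⟩
    oddPart (oddPart (F ⊛ dilate F)) ⊛ C
      ≈⟨ ⊛-cong F⊛F²-3mod4 (inverse-dilate F C F⊛C≈1) ⟩
    (G ⊛ dilate E) ⊛ (F ⊛ dilate C)
      ≈⟨ prove 4 ((g ⊹ e²) ⊹ (f ⊹ c²)) ((g ⊹ f) ⊹ (e² ⊹ c²)) (G ∷ dilate E ∷ F ∷ dilate C ∷ []) ⟩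
    P ⊛ (dilate E ⊛ dilate C)
      ≈⟨ ⊛-cong ≈-refl (dilate-⊛ E C) ⟨
    P ⊛ dilate (E ⊛ C) ∎
    where
    open ≈-Reasoning
    g  = var 0F
    e² = var 1F
    f  = var 2F
    c² = var 3F

  C-7mod8 : oddPart (oddPart (oddPart C)) ≈ G ⊛ E
  C-7mod8 = begin
    oddPart (oddPart (oddPart C))   ≈⟨ (λ n → C-3mod4 (suc (double n))) ⟩
    oddPart (P ⊛ dilate (E ⊛ C))    ≈⟨ oddPart-⊛-dilate P (E ⊛ C) ⟩
    oddPart P ⊛ (E ⊛ C)             ≈⟨ ⊛-cong oddPart-P ≈-refl ⟩
    (G ⊛ F) ⊛ (E ⊛ C)               ≈⟨ prove 4 ((g ⊹ f) ⊹ (e ⊹ c′)) ((g ⊹ e) ⊹ (f ⊹ c′)) (G ∷ F ∷ E ∷ C ∷ []) ⟩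
    (G ⊛ E) ⊛ (F ⊛ C)               ≈⟨ ⊛-cong ≈-refl F⊛C≈1 ⟩
    (G ⊛ E) ⊛ 1ₛ                    ≈⟨ ⊛-identityʳ (G ⊛ E) ⟩
    G ⊛ E                           ∎
    where
    open ≈-Reasoning
    g  = var 0F
    f  = var 1F
    e  = var 2F
    c′ = var 3F

  C-at-16n+13 : ∀ n → C (16 * n + 13) ≡ G n
  C-at-16n+13 n = begin
    C (16 * n + 13)                         ≡⟨ cong C (index n) ⟩
    C (suc (double (double (2 + (4 * n + 1))))) ≡⟨ C-1mod4 (2 + (4 * n + 1)) ⟩
    (q^ 2 ⊛ Y) (2 + (4 * n + 1))           ≡⟨ q^-⊛-shift 2 Y (4 * n + 1) ⟩
    Y (4 * n + 1)                            ≡⟨ cong Y (index-4k+1 n) ⟨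
    Y (suc (double (double n)))                  ≡⟨ oddPart-Y (double n) ⟩
    dilate G (double n)                          ≡⟨ dilate-double G n ⟩
    G n                                          ∎
    where
    open ≡-Reasoning
    index : ∀ n → 16 * n + 13 ≡ suc (double (double (2 + (4 * n + 1))))
    index n = trans (arith n) (sym (index-4k+1 (2 + (4 * n + 1))))
      where
      arith : ∀ n → 16 * n + 13 ≡ 4 * (2 + (4 * n + 1)) + 1
      arith = ℕ-Solver.solve-∀

  C-at-16n+5 : ∀ n → C (16 * n + 5) ≡ 0ℙ
  C-at-16n+5 n = begin
    C (16 * n + 5)                 ≡⟨ cong C (index n) ⟩
    C (suc (double (double (4 * n + 1)))) ≡⟨ C-1mod4 (4 * n + 1) ⟩
    (q^ 2 ⊛ Y) (4 * n + 1)          ≡⟨ vanishes n ⟩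
    0ℙ                                  ∎
    where
    open ≡-Reasoning
    index : ∀ n → 16 * n + 5 ≡ suc (double (double (4 * n + 1)))
    index n = trans (arith n) (sym (index-4k+1 (4 * n + 1)))
      where
      arith : ∀ n → 16 * n + 5 ≡ 4 * (4 * n + 1) + 1
      arith = ℕ-Solver.solve-∀
    vanishes : ∀ n → (q^ 2 ⊛ Y) (4 * n + 1) ≡ 0ℙ
    vanishes zero    = refl
    vanishes (suc m) = begin
      (q^ 2 ⊛ Y) (4 * suc m + 1)     ≡⟨ cong (q^ 2 ⊛ Y) (arith m) ⟩
      (q^ 2 ⊛ Y) (2 + (4 * m + 3)) ≡⟨ q^-⊛-shift 2 Y (4 * m + 3) ⟩
      Y (4 * m + 3)                  ≡⟨ cong Y (index-4k+3 m) ⟨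
      Y (suc (double (suc (double m))))  ≡⟨ oddPart-Y (suc (double m)) ⟩
      dilate G (suc (double m))          ≡⟨ dilate-odd G m ⟩
      0ℙ                                 ∎
      where
      arith : ∀ m → 4 * suc m + 1 ≡ 2 + (4 * m + 3)
      arith = ℕ-Solver.solve-∀

  C-at-8n+7 : ∀ n → C (8 * n + 7) ≡ θ² (λ (x , y) → Q₄ x + Q₁ y) n
  C-at-8n+7 n = begin
    C (8 * n + 7)                               ≡⟨ cong C (index n) ⟩
    C (suc (double (suc (double (suc (double n)))))) ≡⟨ C-7mod8 n ⟩
    (G ⊛ E) n                                       ≡⟨ θ-⊛ Q₄-coercive Q₁-coercive n ⟩
    θ² (λ (x , y) → Q₄ x + Q₁ y) n                ∎
    where
    open ≡-Reasoning
    index : ∀ n → 8 * n + 7 ≡ suc (double (suc (double (suc (double n)))))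
    index n = trans (arith n) (trans (sym (index-4k+3 (2 * n + 1)))
                    (cong (λ m → suc (double (suc (double m)))) (sym (index-2k+1 n))))
      where
      arith : ∀ n → 8 * n + 7 ≡ 4 * (2 * n + 1) + 3
      arith = ℕ-Solver.solve-∀

module Residues where
  open import Data.Nat.Base using (ℕ; zero; suc; _+_; _*_; _^_; _%_; _/_)
  import Data.Nat.Properties as ℕₚ
  open import Data.Nat.Divisibility as ℕD using ()
  open import Data.Nat.DivMod using (m≡m%n+[m/n]*n; [m+kn]%n≡m%n; m*n/n≡m)
  import Data.Nat.Tactic.RingSolver as ℕ-Solver
  open import Data.Product.Base using (_×_; ∃; _,_; proj₁; proj₂)
  open import Data.Sum.Base using (_⊎_; inj₁; inj₂; [_,_]′)
  open import Data.Nat.Primality using (Prime; euclidsLemma)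
  open import Relation.Binary.PropositionalEquality
  open import Relation.Nullary.Decidable.Core using (from-no)
  open import Relation.Nullary.Negation.Core using (¬_)

  Residue : ℕ → Set
  Residue p = p % 20 ≡ 11 ⊎ p % 20 ≡ 19

  residue-split : ∀ {p} → Residue p → ∃ λ q → p ≡ 11 + q * 20 ⊎ p ≡ 19 + q * 20
  residue-split {p} (inj₁ r≡11) = p / 20 , inj₁ (trans (m≡m%n+[m/n]*n p 20) (cong (_+ p / 20 * 20) r≡11))
  residue-split {p} (inj₂ r≡19) = p / 20 , inj₂ (trans (m≡m%n+[m/n]*n p 20) (cong (_+ p / 20 * 20) r≡19))

  residue⇒%4≡3 : ∀ {p} → Residue p → p % 4 ≡ 3
  residue⇒%4≡3 {p} p%20 with residue-split {p} p%20
  ... | q , inj₁ refl = trans (cong (_% 4) (cong (11 +_) (sym (ℕₚ.*-assoc q 5 4)))) ([m+kn]%n≡m%n 11 (q * 5) 4)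
  ... | q , inj₂ refl = trans (cong (_% 4) (cong (19 +_) (sym (ℕₚ.*-assoc q 5 4)))) ([m+kn]%n≡m%n 19 (q * 5) 4)

  residue⇒²≡1[mod40] : ∀ {p} → Residue p → ∃ λ s → p * p ≡ 40 * s + 1
  residue⇒²≡1[mod40] {p} p%20 with residue-split {p} p%20
  ... | q , inj₁ refl = 10 * q * q + 11 * q + 3 , square q
    where
    square : ∀ q → (11 + q * 20) * (11 + q * 20) ≡ 40 * (10 * q * q + 11 * q + 3) + 1
    square = ℕ-Solver.solve-∀
  ... | q , inj₂ refl = 10 * q * q + 19 * q + 9 , square q
    where
    square : ∀ q → (19 + q * 20) * (19 + q * 20) ≡ 40 * (10 * q * q + 19 * q + 9) + 1
    square = ℕ-Solver.solve-∀

  residue⇒∤20 : ∀ {p} → Residue p → ¬ p ℕD.∣ 20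
  residue⇒∤20 {p} p%20 with residue-split {p} p%20
  ... | zero  , inj₁ refl = from-no (11 ℕD.∣? 20)
  ... | zero  , inj₂ refl = from-no (19 ℕD.∣? 20)
  ... | suc q , inj₁ refl = λ p∣20 → ℕₚ.<⇒≱ (ℕₚ.m≤m+n 21 _) (ℕD.∣⇒≤ p∣20)
  ... | suc q , inj₂ refl = λ p∣20 → ℕₚ.<⇒≱ (ℕₚ.m≤m+n 21 _) (ℕD.∣⇒≤ p∣20)

  ≡1[mod40]-^ : ∀ {x s} → x ≡ 40 * s + 1 → ∀ m → ∃ λ u → x ^ m ≡ 40 * u + 1
  ≡1[mod40]-^ x≡ zero = 0 , refl
  ≡1[mod40]-^ {x} {s} x≡ (suc m) =
    let (u , x^m≡) = ≡1[mod40]-^ {x} {s} x≡ m in 40 * s * u + s + u , trans (cong₂ _*_ x≡ x^m≡) (product s u)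
    where
    product : ∀ s u → (40 * s + 1) * (40 * u + 1) ≡ 40 * (40 * s * u + s + u) + 1
    product = ℕ-Solver.solve-∀

  residue⇒^[2k+2]≡1[mod40] : ∀ {p} → Residue p → ∀ k → ∃ λ u → p ^ (2 * k + 2) ≡ 40 * u + 1
  residue⇒^[2k+2]≡1[mod40] {p} p%20 k = proj₁ [p²]^[1+k]≡ , (begin
    p ^ (2 * k + 2)       ≡⟨ cong (p ^_) (exponent k) ⟩
    p ^ (2 * suc k)         ≡⟨ ℕₚ.^-*-assoc p 2 (suc k) ⟨
    (p ^ 2) ^ suc k           ≡⟨ cong (λ m → (p * m) ^ suc k) (ℕₚ.*-identityʳ p) ⟩
    (p * p) ^ suc k         ≡⟨ proj₂ [p²]^[1+k]≡ ⟩
    40 * proj₁ [p²]^[1+k]≡ + 1 ∎)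
    where
    open ≡-Reasoning
    exponent : ∀ k → 2 * k + 2 ≡ 2 * suc k
    exponent = ℕ-Solver.solve-∀
    [p²]^[1+k]≡ : ∃ λ u → (p * p) ^ suc k ≡ 40 * u + 1
    [p²]^[1+k]≡ = ≡1[mod40]-^ {s = proj₁ (residue⇒²≡1[mod40] {p} p%20)} (proj₂ (residue⇒²≡1[mod40] {p} p%20)) (suc k)

  -- p^(2k+2) ≡ 1 (mod 40) is what makes the division by 5 exact.
  residue-index : ∀ {p} → Residue p → ∀ n k → ∃ λ n′ →
    (8 * p ^ (2 * k + 1) * n + (34 * p ^ (2 * k + 2) + 1) / 5 ≡ 8 * n′ + 7) ×
    (20 * n′ + 17 ≡ p ^ (2 * k + 1) * (20 * n + 17 * p))
  residue-index {p} p%20 n k = P * n + 34 * u , index≡ , sum-of-squares-form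
    where
    open ≡-Reasoning
    u : ℕ
    u = proj₁ (residue⇒^[2k+2]≡1[mod40] {p} p%20 k)
    Q≡40u+1 : p ^ (2 * k + 2) ≡ 40 * u + 1
    Q≡40u+1 = proj₂ (residue⇒^[2k+2]≡1[mod40] {p} p%20 k)
    P = p ^ (2 * k + 1)
    Q = p ^ (2 * k + 2)
    Q≡P*p : Q ≡ P * p
    Q≡P*p = trans (cong (p ^_) (exponent k)) (ℕₚ.*-comm p P)
      where
      exponent : ∀ k → 2 * k + 2 ≡ suc (2 * k + 1)
      exponent = ℕ-Solver.solve-∀
    index≡ : 8 * P * n + (34 * Q + 1) / 5 ≡ 8 * (P * n + 34 * u) + 7
    index≡ = begin
      8 * P * n + (34 * Q + 1) / 5                ≡⟨ cong (λ m → 8 * P * n + (34 * m + 1) / 5) Q≡40u+1 ⟩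
      8 * P * n + (34 * (40 * u + 1) + 1) / 5 ≡⟨ cong (λ m → 8 * P * n + m / 5) (times-5 u) ⟩
      8 * P * n + (272 * u + 7) * 5 / 5         ≡⟨ cong (8 * P * n +_) (m*n/n≡m (272 * u + 7) 5) ⟩
      8 * P * n + (272 * u + 7)                   ≡⟨ collect P n u ⟩
      8 * (P * n + 34 * u) + 7                    ∎
      where
      times-5 : ∀ u → 34 * (40 * u + 1) + 1 ≡ (272 * u + 7) * 5
      times-5 = ℕ-Solver.solve-∀
      collect : ∀ P n u → 8 * P * n + (272 * u + 7) ≡ 8 * (P * n + 34 * u) + 7
      collect = ℕ-Solver.solve-∀
    sum-of-squares-form : 20 * (P * n + 34 * u) + 17 ≡ P * (20 * n + 17 * p)
    sum-of-squares-form = begin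
      20 * (P * n + 34 * u) + 17       ≡⟨ expand P n u ⟩
      20 * P * n + 17 * (40 * u + 1) ≡⟨ cong (λ m → 20 * P * n + 17 * m) (trans (sym Q≡40u+1) Q≡P*p) ⟩
      20 * P * n + 17 * (P * p)        ≡⟨ factor P n p ⟩
      P * (20 * n + 17 * p)              ∎
      where
      expand : ∀ P n u → 20 * (P * n + 34 * u) + 17 ≡ 20 * P * n + 17 * (40 * u + 1)
      expand = ℕ-Solver.solve-∀
      factor : ∀ P n p → 20 * P * n + 17 * (P * p) ≡ P * (20 * n + 17 * p)
      factor = ℕ-Solver.solve-∀

  residue⇒∤20n+17p : ∀ {p} → Prime p → Residue p → ∀ {n} → ¬ p ℕD.∣ n → ¬ p ℕD.∣ 20 * n + 17 * p
  residue⇒∤20n+17p {p} p-prime p%20 {n} p∤n p∣20n+17p = [ residue⇒∤20 p%20 , p∤n ]′ (euclidsLemma 20 n p-prime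
    (ℕD.∣m+n∣m⇒∣n (subst (p ℕD.∣_) (ℕₚ.+-comm (20 * n) (17 * p)) p∣20n+17p) (ℕD.n∣m*n 17)))

open import Data.Nat as ℕ using (ℕ; _∸_; _^_; _%_; _/_)
open import Data.Nat.Primality using (Prime)
open import Data.Integer using (ℤ; +_; _+_; _*_)
open import Data.Integer.Divisibility using (_∣_)
open import Data.Nat.Divisibility as ℕD using ()
open import Data.Product using (_×_; ∃)
open import Data.Sum using (_⊎_)
open import Relation.Nullary using (¬_)
open import Relation.Binary.PropositionalEquality using (_≡_)
open import Function.Bundles using (_⇔_)
open import Data.Integer.Base using (∣_∣)
open import Data.Parity.Base using (0ℙ)
open import Data.Product.Base using (_,_)
open import Function.Base using (_∘_)
open import Function.Bundles using (mk⇔; Equivalence)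
open import Relation.Binary.PropositionalEquality using (sym; trans; cong)
open PowerSeries using (0ℙ≢1ℙ; ≢1ℙ⇒≡0ℙ)
open Reduction using (parityℤ≡0ℙ⇔2∣)
open ThetaSeries using (θ²; θ²-≡0ℙ)
open Exponents using (Q₄; Q₁; θ-Q₄≡1ℙ⇔; sum-of-squares)
open SumsOfTwoSquares using (sum-of-squares≢)
open Residues using (Residue; residue⇒%4≡3; residue⇒∤20n+17p; residue-index)

θ²-Q₄+Q₁≡0ℙ : ∀ {p} → Prime p → p % 4 ≡ 3 → ∀ k {w n} → ¬ p ℕD.∣ w →
               20 ℕ.* n ℕ.+ 17 ≡ p ^ (2 ℕ.* k ℕ.+ 1) ℕ.* w → θ² (λ (x , y) → Q₄ x ℕ.+ Q₁ y) n ≡ 0ℙ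
θ²-Q₄+Q₁≡0ℙ p-prime p%4≡3 k {w} {n} p∤w 20n+17≡ = θ²-≡0ℙ {λ (x , y) → Q₄ x ℕ.+ Q₁ y} {n} λ (x , y) Q₄x+Q₁y≡n →
  sum-of-squares≢ p-prime p%4≡3 k ∣ + 10 * x + + 4 ∣ ∣ + 10 * y + + 1 ∣ w p∤w
    (trans (sym (sum-of-squares x y)) (trans (cong (λ m → 20 ℕ.* m ℕ.+ 17) Q₄x+Q₁y≡n) 20n+17≡))

theorem3p1 : (c : ℕ → ℤ) → IsC 7 3 c →
    ((n : ℕ) → (+ 2) ∣ c (16 ℕ.* n ℕ.+ 5))
    × ((n : ℕ) → ((+ 2) ∣ c (16 ℕ.* n ℕ.+ 13)
                   ⇔ (¬ ∃ λ (k : ℤ) → + n ≡ + 5 * k * k + + 4 * k)))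
    × ((p : ℕ) → Prime p → (p % 20 ≡ 11 ⊎ p % 20 ≡ 19) →
       (n k : ℕ) → ¬ (p ℕD.∣ n) →
       (+ 2) ∣ c (8 ℕ.* p ^ (2 ℕ.* k ℕ.+ 1) ℕ.* n
                  ℕ.+ (34 ℕ.* p ^ (2 ℕ.* k ℕ.+ 2) ℕ.+ 1) / 5))
theorem3p1 c isC = part1 , part2 , part3
  where
  open Dissection c isC using (C; C-at-16n+5; C-at-16n+13; C-at-8n+7)
  even : ∀ m → C m ≡ 0ℙ → + 2 ∣ c m
  even m = Equivalence.to (parityℤ≡0ℙ⇔2∣ (c m))
  part1 : ∀ n → + 2 ∣ c (16 ℕ.* n ℕ.+ 5)
  part1 n = even _ (C-at-16n+5 n)
  part2 : ∀ n → + 2 ∣ c (16 ℕ.* n ℕ.+ 13) ⇔ (¬ ∃ λ k → + n ≡ + 5 * k * k + + 4 * k)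
  part2 n = mk⇔
    (λ 2∣c ex → 0ℙ≢1ℙ (trans (sym (Equivalence.from (parityℤ≡0ℙ⇔2∣ (c (16 ℕ.* n ℕ.+ 13))) 2∣c))
                             (trans (C-at-16n+13 n) (Equivalence.from (θ-Q₄≡1ℙ⇔ n) ex))))
    (λ ¬ex → even _ (trans (C-at-16n+13 n) (≢1ℙ⇒≡0ℙ (¬ex ∘ Equivalence.to (θ-Q₄≡1ℙ⇔ n)))))
  part3 : ∀ p → Prime p → Residue p → ∀ n k → ¬ p ℕD.∣ n →
          + 2 ∣ c (8 ℕ.* p ^ (2 ℕ.* k ℕ.+ 1) ℕ.* n ℕ.+ (34 ℕ.* p ^ (2 ℕ.* k ℕ.+ 2) ℕ.+ 1) / 5)
  part3 p p-prime p%20 n k p∤n =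
    let (n′ , index≡ , 20n′+17≡) = residue-index {p} p%20 n k in
    even _ (trans (cong C index≡) (trans (C-at-8n+7 n′)
      (θ²-Q₄+Q₁≡0ℙ p-prime (residue⇒%4≡3 {p} p%20) k {n = n′} (residue⇒∤20n+17p p-prime p%20 p∤n) 20n′+17≡)))
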